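{- There exists $m_0\in\mathbb{N}$ such that for every $m\ge m_0$, every $k\in\mathbb{N}$ and every $\sigma\in S_{km}$, there exists $\rho\in S_{km}$ such that $C_1(\rho)\supseteq C_1(\sigma)$, $w(\rho)\le\lceil\sqrt[3]{m}\rceil$, $d(\rho,\sigma)\le\frac{9}{\sqrt[3]{m}}$, and $\rho=\Phi(\tilde\rho)$ for some $\tilde\rho\in S_m$ and some isometric embedding $\Phi:S_m\to S_{km}$.
   Context: $S_n$ is the symmetric group on $\{1,\dots,n\}$ with normalized Hamming distance $d(\sigma,\tau)=\frac1n|\{i:\sigma(i)\ne\tau(i)\}|$. For $\sigma\in S_n$ and $l\ge1$, $C_l(\sigma)$ is the set of cycles of $\sigma$ of length $l$ (so $C_1(\sigma)$ is the set of fixed points), and $w(\sigma)$ is the greatest $l$ with $C_l(\sigma)\ne\varnothing$. An isometric embedding $S_m\to S_{km}$ is an injective group homomorphism preserving the normalized Hamming distance. -}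

module Defs where

open import Data.Nat using (ℕ; zero; suc; _+_; _*_; _^_; _≤_; _<_; _≤?_)
open import Data.Fin using (Fin; _≟_)
open import Data.List using (List; length; filter; allFin)
open import Data.Product using (Σ; _×_; ∃)
open import Relation.Nullary using (¬_; yes; no; ¬?)
open import Relation.Binary.PropositionalEquality using (_≡_; _≢_)
open import Data.Fin.Permutation using (Permutation′; _⟨$⟩ʳ_; _∘ₚ_; _≈_)

-- S_n is represented by Permutation′ n (bijections of Fin n).

-- Unnormalised Hamming distance: |{ i : σ(i) ≠ τ(i) }|.
-- The normalised distance is d(σ,τ) = hamming σ τ / n.
hamming : ∀ {n} → Permutation′ n → Permutation′ n → ℕ
hamming {n} σ τ = length (filter (λ i → ¬? (σ ⟨$⟩ʳ i ≟ τ ⟨$⟩ʳ i)) (allFin n))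

pow : ∀ {n} → Permutation′ n → ℕ → Fin n → Fin n
pow σ zero    i = i
pow σ (suc l) i = σ ⟨$⟩ʳ (pow σ l i)

-- The point i lies on a cycle of σ of length l (i.e. on an element of C_l(σ)).
OnCycleOfLength : ∀ {n} → Permutation′ n → Fin n → ℕ → Set
OnCycleOfLength σ i l =
  (1 ≤ l) × (pow σ l i ≡ i) × (∀ j → 1 ≤ j → j < l → pow σ j i ≢ i)

HasCycleOfLength : ∀ {n} → Permutation′ n → ℕ → Set
HasCycleOfLength σ l = ∃ λ i → OnCycleOfLength σ i l

-- w(σ) ≤ c : every l with C_l(σ) ≠ ∅ satisfies l ≤ c.
MaxCycleLen≤ : ∀ {n} → Permutation′ n → ℕ → Set
MaxCycleLen≤ σ c = ∀ l → HasCycleOfLength σ l → l ≤ c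

FixedPointsSup : ∀ {n} → Permutation′ n → Permutation′ n → Set
FixedPointsSup ρ σ = ∀ i → σ ⟨$⟩ʳ i ≡ i → ρ ⟨$⟩ʳ i ≡ i

-- ⌈ ∛ m ⌉ : the least c with m ≤ c ^ 3 (bounded search from 0).
ceilCbrt-go : ℕ → ℕ → ℕ → ℕ
ceilCbrt-go m zero       c = c
ceilCbrt-go m (suc fuel) c with m ≤? c ^ 3
... | yes _ = c
... | no  _ = ceilCbrt-go m fuel (suc c)

ceilCbrt : ℕ → ℕ
ceilCbrt m = ceilCbrt-go m (suc m) 0

-- Isometric embedding S_m → S_{n} (normalised Hamming distance preserved):
-- respects equality of permutations, is a group homomorphism, injective, and
--   hamming (Φ σ) (Φ τ) / n = hamming σ τ / m   (stated cross-multiplied).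
IsIsometricEmbedding : ∀ {m n} → (Permutation′ m → Permutation′ n) → Set
IsIsometricEmbedding {m} {n} Φ =
  (∀ σ τ → σ ≈ τ → Φ σ ≈ Φ τ) ×
  (∀ σ τ → Φ (σ ∘ₚ τ) ≈ (Φ σ ∘ₚ Φ τ)) ×
  (∀ σ τ → Φ σ ≈ Φ τ → σ ≈ τ) ×
  (∀ σ τ → hamming (Φ σ) (Φ τ) * m ≡ hamming σ τ * n)

module Submission where

-- A *bundle* is a k-tuple of disjoint point sequences of
-- one length l + 1.  Bundles of total length m covering Fin (k * m) label Fin (k * m)
-- by Fin k × Fin m, i.e. give P ∈ S_{km}; rotating every sequence is then
-- ρ = P ∘ diagonal(ρ̃) ∘ P⁻¹, where ρ̃ ∈ S_m has one (l+1)-cycle per bundle, and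
-- τ ↦ P ∘ diagonal(τ) ∘ P⁻¹ is an isometric embedding S_m → S_{km} (`realise`).
-- The distance of ρ to σ is the cost of the bundles: the steps of the rotated
-- sequences not made by σ.  Bundles are built from the cycle decomposition of σ
-- (`Orbits`) with c = ⌈∛m⌉ (`bundling`): cycles of each length ≤ c are bundled k at a
-- time at no cost; the cycles of length > c are concatenated, cut into blocks of c
-- points and bundled k at a time, costing one per block and per cycle; the O(k c²)
-- points left over become fixed points.  Counting gives cost · c ≤ 2km + 3kc³ ≤ 9km,
-- which is d(ρ,σ) ≤ 9/∛m.

open import Data.Nat
open import Data.Nat.Properties
open import Data.Empty using (⊥; ⊥-elim)
open import Data.Sum using (inj₁; inj₂; [_,_]′)
open import Data.Product using (Σ; _×_; _,_; proj₁; proj₂; ∃)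
open import Data.Fin as F using (Fin; zero; suc; toℕ; _↑ˡ_; _↑ʳ_; combine; remQuot; splitAt)
open import Data.Fin.Properties as FP
  using ( toℕ-injective; toℕ-fromℕ<; toℕ-fromℕ; toℕ-inject₁; toℕ<n
        ; splitAt-↑ˡ; splitAt-↑ʳ; remQuot-combine; combine-remQuot; combine-injectiveʳ)
open import Data.List as L using (List; []; _∷_; _++_; length; filter; allFin; tabulate)
open import Data.List.Relation.Unary.All as All using (All; []; _∷_)
import Data.List.Relation.Unary.All.Properties as All
open import Data.List.Relation.Unary.Any as Any using (here; there)
open import Data.List.Relation.Unary.Any.Properties using (lookup-index)
open import Data.List.Membership.Propositional using (_∈_)
open import Data.List.Membership.Propositional.Properties
  using (∈-++⁺ˡ; ∈-++⁺ʳ; ∈-++⁻; ∈-filter⁺; ∈-filter⁻; ∈-allFin) renaming (∈-lookup to ∈-lookup′)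
import Data.List.Relation.Unary.Unique.Propositional.Properties as Unique
open import Relation.Binary using (tri<; tri≈; tri>)
open import Data.List.Relation.Unary.AllPairs using ([]; _∷_)
open import Data.List.Relation.Unary.Unique.Propositional using (Unique)
open import Data.Vec as V using (Vec; lookup; toList)
open import Data.Vec.Properties using (lookup∘tabulate; length-toList; toList∘fromList)
open import Data.List.Properties using (length-++; ++-assoc; length-map)
open import Data.List.Relation.Binary.Permutation.Propositional
  using (_↭_; ↭-refl; ↭-reflexive; ↭-trans; ↭⇒↭ₛ; module PermutationReasoning)
import Data.List.Relation.Binary.Permutation.Propositional.Properties as ↭
import Data.List.Relation.Binary.Permutation.Setoid.Properties as ↭ₛ
open import Data.Nat.Tactic.RingSolver using (solve-∀)
open import Data.Vec.Membership.Propositional.Properties using (∈-lookup; ∈-toList⁺)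
open import Relation.Nullary using (¬_; yes; no; ¬?; Dec)
open import Data.Nat.Induction using (<-rec)
open import Relation.Binary.PropositionalEquality
open import Data.Fin.Permutation
  using (Permutation′; _⟨$⟩ʳ_; _⟨$⟩ˡ_; _∘ₚ_; _≈_; permutation; inverseˡ; inverseʳ; flip)
open import Algebra.Properties.CommutativeMonoid.Sum +-0-commutativeMonoid
  using (sum; sum-cong-≗; sum-permute; sum-init-last)
open import Defs

sum-const : ∀ n c → sum {n} (λ _ → c) ≡ n * c
sum-const zero    c = refl
sum-const (suc n) c = cong (c +_) (sum-const n c)

sum-mono : ∀ {n} {f g : Fin n → ℕ} → (∀ i → f i ≤ g i) → sum f ≤ sum g
sum-mono {zero}  f≤g = z≤n
sum-mono {suc n} f≤g = +-mono-≤ (f≤g zero) (sum-mono (λ i → f≤g (suc i)))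

sum-+ : ∀ {n} (f g : Fin n → ℕ) → sum (λ i → f i + g i) ≡ sum f + sum g
sum-+ {zero}  f g = refl
sum-+ {suc n} f g = begin
    (f zero + g zero) + sum (λ i → f (suc i) + g (suc i))
  ≡⟨ cong ((f zero + g zero) +_) (sum-+ (λ i → f (suc i)) (λ i → g (suc i))) ⟩
    (f zero + g zero) + (sum (λ i → f (suc i)) + sum (λ i → g (suc i)))
  ≡⟨ +-assoc-swap (f zero) (g zero) _ _ ⟩
    (f zero + sum (λ i → f (suc i))) + (g zero + sum (λ i → g (suc i))) ∎
  where
  open ≡-Reasoning
  +-assoc-swap : ∀ a b c d → (a + b) + (c + d) ≡ (a + c) + (b + d)
  +-assoc-swap a b c d = begin
      (a + b) + (c + d)  ≡⟨ +-assoc a b (c + d) ⟩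
      a + (b + (c + d))  ≡⟨ cong (a +_) (+-comm b (c + d)) ⟩
      a + ((c + d) + b)  ≡⟨ cong (a +_) (+-assoc c d b) ⟩
      a + (c + (d + b))  ≡⟨ cong (λ z → a + (c + z)) (+-comm d b) ⟩
      a + (c + (b + d))  ≡⟨ sym (+-assoc a c (b + d)) ⟩
      (a + c) + (b + d)  ∎

sum-++ : ∀ m {n} (f : Fin (m + n) → ℕ) → sum f ≡ sum (λ i → f (i ↑ˡ n)) + sum (λ i → f (m ↑ʳ i))
sum-++ zero    f = refl
sum-++ (suc m) f =
  trans (cong (f zero +_) (sum-++ m (λ i → f (suc i)))) (sym (+-assoc (f zero) _ _))

sum-combine : ∀ k {m} (f : Fin (k * m) → ℕ) → sum f ≡ sum {k} (λ j → sum {m} (λ a → f (combine j a)))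
sum-combine zero    f = refl
sum-combine (suc k) {m} f =
  trans (sum-++ m f) (cong (sum (λ a → f (a ↑ˡ (k * m))) +_) (sum-combine k (λ i → f (m ↑ʳ i))))

mismatch : ∀ {n} → Fin n → Fin n → ℕ
mismatch a b with a F.≟ b
... | yes _ = 0
... | no  _ = 1

mismatch-refl : ∀ {n} (a : Fin n) → mismatch a a ≡ 0
mismatch-refl a with a F.≟ a
... | yes _  = refl
... | no a≢a = ⊥-elim (a≢a refl)

mismatch≤1 : ∀ {n} (a b : Fin n) → mismatch a b ≤ 1
mismatch≤1 a b with a F.≟ b
... | yes _ = z≤n
... | no  _ = s≤s z≤n

mismatch-injective : ∀ {n n′} (h : Fin n → Fin n′) → (∀ {x y} → h x ≡ h y → x ≡ y) →
                     ∀ a b → mismatch (h a) (h b) ≡ mismatch a b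
mismatch-injective h h-inj a b with h a F.≟ h b | a F.≟ b
... | yes _   | yes _   = refl
... | no  _   | no  _   = refl
... | yes ha≡hb | no a≢b  = ⊥-elim (a≢b (h-inj ha≡hb))
... | no ha≢hb  | yes refl = ⊥-elim (ha≢hb refl)

hamming≡sum : ∀ {n} (σ τ : Permutation′ n) → hamming σ τ ≡ sum (λ i → mismatch (σ ⟨$⟩ʳ i) (τ ⟨$⟩ʳ i))
hamming≡sum σ τ = count (λ i → i)
  where
  count : ∀ {n′} (h : Fin n′ → Fin _) →
          length (filter (λ i → ¬? (σ ⟨$⟩ʳ i F.≟ τ ⟨$⟩ʳ i)) (tabulate h))
          ≡ sum (λ i → mismatch (σ ⟨$⟩ʳ h i) (τ ⟨$⟩ʳ h i))
  count {zero}   h = refl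
  count {suc n′} h with σ ⟨$⟩ʳ h zero F.≟ τ ⟨$⟩ʳ h zero
  ... | yes _ = count (λ i → h (suc i))
  ... | no  _ = cong suc (count (λ i → h (suc i)))

iter : ∀ {A : Set} → (A → A) → ℕ → A → A
iter f zero    x = x
iter f (suc s) x = f (iter f s x)

iter-+ : ∀ {A : Set} (f : A → A) a b x → iter f (a + b) x ≡ iter f a (iter f b x)
iter-+ f zero    b x = refl
iter-+ f (suc a) b x = cong f (iter-+ f a b x)

pow≡iter : ∀ {n} (σ : Permutation′ n) s x → pow σ s x ≡ iter (σ ⟨$⟩ʳ_) s x
pow≡iter σ zero    x = refl
pow≡iter σ (suc s) x = cong (σ ⟨$⟩ʳ_) (pow≡iter σ s x)

rotate : ∀ {l} → Fin (suc l) → Fin (suc l)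
rotate {l} t with toℕ t ≟ l
... | yes _   = zero
... | no  t≢l = suc (F.fromℕ< (≤∧≢⇒< (≤-pred (toℕ<n t)) t≢l))

rotate⁻¹ : ∀ {l} → Fin (suc l) → Fin (suc l)
rotate⁻¹ {l} zero    = F.fromℕ l
rotate⁻¹     (suc t) = F.inject₁ t

toℕ-rotate : ∀ {l} (t : Fin (suc l)) → toℕ t ≢ l → toℕ (rotate t) ≡ suc (toℕ t)
toℕ-rotate {l} t t≢l with toℕ t ≟ l
... | yes t≡l = ⊥-elim (t≢l t≡l)
... | no  _   = cong suc (toℕ-fromℕ< _)

rotate-last : ∀ {l} (t : Fin (suc l)) → toℕ t ≡ l → rotate t ≡ zero
rotate-last {l} t t≡l with toℕ t ≟ l
... | yes _   = refl
... | no  t≢l = ⊥-elim (t≢l t≡l)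

rotate-inject₁ : ∀ {l} (t : Fin l) → rotate (F.inject₁ t) ≡ suc t
rotate-inject₁ {l} t = toℕ-injective (trans (toℕ-rotate (F.inject₁ t) t≢l) (cong suc (toℕ-inject₁ t)))
  where
  t≢l : toℕ (F.inject₁ t) ≢ l
  t≢l e = <-irrefl (trans (sym (toℕ-inject₁ t)) e) (toℕ<n t)

rotate-rotate⁻¹ : ∀ {l} (x : Fin (suc l)) → rotate (rotate⁻¹ x) ≡ x
rotate-rotate⁻¹ {l} zero    = rotate-last (F.fromℕ l) (toℕ-fromℕ l)
rotate-rotate⁻¹     (suc t) = rotate-inject₁ t

rotate⁻¹-rotate : ∀ {l} (t : Fin (suc l)) → rotate⁻¹ (rotate t) ≡ t
rotate⁻¹-rotate {l} t with toℕ t ≟ l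
... | yes t≡l = toℕ-injective (trans (toℕ-fromℕ l) (sym t≡l))
... | no  _   = toℕ-injective (trans (toℕ-inject₁ _) (toℕ-fromℕ< _))

toℕ-iter-rotate : ∀ {l} s (t : Fin (suc l)) → toℕ t + s ≤ l → toℕ (iter rotate s t) ≡ toℕ t + s
toℕ-iter-rotate zero    t _    = sym (+-identityʳ _)
toℕ-iter-rotate {l} (suc s) t t+s<l =
  trans (toℕ-rotate (iter rotate s t) not-last) (trans (cong suc ih) (sym (+-suc _ s)))
  where
  ih : toℕ (iter rotate s t) ≡ toℕ t + s
  ih = toℕ-iter-rotate s t (≤-trans (+-monoʳ-≤ (toℕ t) (n≤1+n s)) t+s<l)
  not-last : toℕ (iter rotate s t) ≢ l
  not-last e = <-irrefl (trans (sym ih) e) (≤-trans (≤-reflexive (sym (+-suc (toℕ t) s))) t+s<l)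

-- rotate has period l + 1: from t, l − t steps reach the last position,
-- one more step reaches 0 and t further steps return to t.
rotate-period : ∀ {l} (t : Fin (suc l)) → iter rotate (suc l) t ≡ t
rotate-period {l} t = begin
    iter rotate (suc l) t
  ≡⟨ cong (λ z → iter rotate z t) split-l ⟩
    iter rotate (toℕ t + suc (l ∸ toℕ t)) t
  ≡⟨ iter-+ rotate (toℕ t) (suc (l ∸ toℕ t)) t ⟩
    iter rotate (toℕ t) (rotate (iter rotate (l ∸ toℕ t) t))
  ≡⟨ cong (iter rotate (toℕ t)) reaches-zero ⟩
    iter rotate (toℕ t) zero
  ≡⟨ toℕ-injective (toℕ-iter-rotate (toℕ t) zero t≤l) ⟩
    t ∎
  where
  open ≡-Reasoning
  t≤l : toℕ t ≤ l
  t≤l = ≤-pred (toℕ<n t)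
  split-l : suc l ≡ toℕ t + suc (l ∸ toℕ t)
  split-l = trans (cong suc (sym (m+[n∸m]≡n t≤l))) (sym (+-suc (toℕ t) (l ∸ toℕ t)))
  reaches-zero : rotate (iter rotate (l ∸ toℕ t) t) ≡ zero
  reaches-zero = rotate-last _ (trans (toℕ-iter-rotate (l ∸ toℕ t) t (≤-reflexive (m+[n∸m]≡n t≤l)))
                                      (m+[n∸m]≡n t≤l))

data SplitView (a b : ℕ) : Fin (a + b) → Set where
  left  : (t : Fin a) → SplitView a b (t ↑ˡ b)
  right : (u : Fin b) → SplitView a b (a ↑ʳ u)

splitView : ∀ a b (x : Fin (a + b)) → SplitView a b x
splitView zero    b x       = right x
splitView (suc a) b zero    = left zero
splitView (suc a) b (suc x) with splitView a b x
... | left t  = left (suc t)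
... | right u = right u

module _ {a b : ℕ} where

  _⊕_ : (Fin a → Fin a) → (Fin b → Fin b) → Fin (a + b) → Fin (a + b)
  (f ⊕ g) x = [ (λ t → f t ↑ˡ b) , (λ u → a ↑ʳ g u) ]′ (splitAt a x)

  ⊕-↑ˡ : ∀ f g (t : Fin a) → (f ⊕ g) (t ↑ˡ b) ≡ f t ↑ˡ b
  ⊕-↑ˡ f g t rewrite splitAt-↑ˡ a t b = refl

  ⊕-↑ʳ : ∀ f g (u : Fin b) → (f ⊕ g) (a ↑ʳ u) ≡ a ↑ʳ g u
  ⊕-↑ʳ f g u rewrite splitAt-↑ʳ a b u = refl

  ⊕-inverse : ∀ f g f⁻¹ g⁻¹ → (∀ t → f⁻¹ (f t) ≡ t) → (∀ u → g⁻¹ (g u) ≡ u) →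
              ∀ x → (f⁻¹ ⊕ g⁻¹) ((f ⊕ g) x) ≡ x
  ⊕-inverse f g f⁻¹ g⁻¹ inv-f inv-g x with splitView a b x
  ... | left t  = trans (cong (f⁻¹ ⊕ g⁻¹) (⊕-↑ˡ f g t)) (trans (⊕-↑ˡ f⁻¹ g⁻¹ (f t)) (cong (_↑ˡ b) (inv-f t)))
  ... | right u = trans (cong (f⁻¹ ⊕ g⁻¹) (⊕-↑ʳ f g u)) (trans (⊕-↑ʳ f⁻¹ g⁻¹ (g u)) (cong (a ↑ʳ_) (inv-g u)))

  iter-⊕-↑ˡ : ∀ f g s (t : Fin a) → iter (f ⊕ g) s (t ↑ˡ b) ≡ iter f s t ↑ˡ b
  iter-⊕-↑ˡ f g zero    t = refl
  iter-⊕-↑ˡ f g (suc s) t = trans (cong (f ⊕ g) (iter-⊕-↑ˡ f g s t)) (⊕-↑ˡ f g _)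

  iter-⊕-↑ʳ : ∀ f g s (u : Fin b) → iter (f ⊕ g) s (a ↑ʳ u) ≡ a ↑ʳ iter g s u
  iter-⊕-↑ʳ f g zero    u = refl
  iter-⊕-↑ʳ f g (suc s) u = trans (cong (f ⊕ g) (iter-⊕-↑ʳ f g s u)) (⊕-↑ʳ f g _)

unique-++⁻ : ∀ {A : Set} (xs : List A) {ys} → Unique (xs ++ ys) →
             Unique xs × Unique ys × (∀ {v} → v ∈ xs → v ∈ ys → ⊥)
unique-++⁻ []       u         = [] , u , λ ()
unique-++⁻ (x ∷ xs) (x∉ ∷ u) with unique-++⁻ xs u
... | u-xs , u-ys , disjoint = All.++⁻ˡ xs x∉ ∷ u-xs , u-ys , disjoint′
  where
  disjoint′ : ∀ {v} → v ∈ x ∷ xs → v ∈ _ → ⊥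
  disjoint′ (here refl) v∈ys = All.lookup (All.++⁻ʳ xs x∉) v∈ys refl
  disjoint′ (there v∈xs) v∈ys = disjoint v∈xs v∈ys

unique-resp-↭ : ∀ {A : Set} {xs ys : List A} → xs ↭ ys → Unique xs → Unique ys
unique-resp-↭ {A} xs↭ys = ↭ₛ.Unique-resp-↭ (setoid A) (↭⇒↭ₛ xs↭ys)

lookup∈toList : ∀ {A : Set} {L} (v : Vec A L) t → lookup v t ∈ toList v
lookup∈toList v t = ∈-toList⁺ (∈-lookup t v)

unique⇒lookup-injective : ∀ {A : Set} {L} (v : Vec A L) → Unique (toList v) →
                          ∀ {t t′} → lookup v t ≡ lookup v t′ → t ≡ t′
unique⇒lookup-injective (x V.∷ v) u        {zero}  {zero}   e = refl
unique⇒lookup-injective (x V.∷ v) (x∉ ∷ u) {zero}  {suc t′} e = ⊥-elim (All.lookup x∉ (lookup∈toList v t′) e)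
unique⇒lookup-injective (x V.∷ v) (x∉ ∷ u) {suc t} {zero}   e = ⊥-elim (All.lookup x∉ (lookup∈toList v t) (sym e))
unique⇒lookup-injective (x V.∷ v) (x∉ ∷ u) {suc t} {suc t′} e = cong suc (unique⇒lookup-injective v u e)

∈toList⇒lookup : ∀ {A : Set} {L} (v : Vec A L) {y} → y ∈ toList v → Σ (Fin L) λ t → lookup v t ≡ y
∈toList⇒lookup (x V.∷ v) (here refl) = zero , refl
∈toList⇒lookup (x V.∷ v) (there p) with ∈toList⇒lookup v p
... | t , e = suc t , e

lookup-injective⇒unique : ∀ {A : Set} {L} (v : Vec A L) → (∀ {t t′} → lookup v t ≡ lookup v t′ → t ≡ t′) →
                          Unique (toList v)
lookup-injective⇒unique V.[]       inj = []
lookup-injective⇒unique (x V.∷ v) inj =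
  All.tabulate (λ y∈v x≡y → zero≢suc (inj (trans x≡y (sym (proj₂ (∈toList⇒lookup v y∈v)))))) ∷
  lookup-injective⇒unique v (λ e → FP.suc-injective (inj e))
  where
  zero≢suc : ∀ {L} {t : Fin L} → zero ≢ suc t
  zero≢suc ()

unique⇒lookupₗ-injective : ∀ {A : Set} (xs : List A) → Unique xs → ∀ {t t′} → L.lookup xs t ≡ L.lookup xs t′ → t ≡ t′
unique⇒lookupₗ-injective (x ∷ xs) u        {zero}  {zero}   e = refl
unique⇒lookupₗ-injective (x ∷ xs) (x∉ ∷ u) {zero}  {suc t′} e = ⊥-elim (All.lookup x∉ (∈-lookup′ t′) e)
unique⇒lookupₗ-injective (x ∷ xs) (x∉ ∷ u) {suc t} {zero}   e = ⊥-elim (All.lookup x∉ (∈-lookup′ t) (sym e))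
unique⇒lookupₗ-injective (x ∷ xs) (x∉ ∷ u) {suc t} {suc t′} e = cong suc (unique⇒lookupₗ-injective xs u e)

unique-complete⇒length : ∀ {N} (xs : List (Fin N)) → Unique xs → (∀ x → x ∈ xs) → length xs ≡ N
unique-complete⇒length xs unique complete =
  ≤-antisym (FP.injective⇒≤ (unique⇒lookupₗ-injective xs unique))
            (FP.injective⇒≤ {f = λ x → Any.index (complete x)} index-injective)
  where
  index-injective : ∀ {x y} → Any.index (complete x) ≡ Any.index (complete y) → x ≡ y
  index-injective {x} {y} e =
    trans (lookup-index (complete x)) (trans (cong (L.lookup xs) e) (sym (lookup-index (complete y))))

argmin : ∀ {L} (g : Fin (suc L) → ℕ) → Σ (Fin (suc L)) λ t₀ → ∀ t → g t₀ ≤ g t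
argmin {zero}  g = zero , λ { zero → ≤-refl }
argmin {suc L} g with argmin (λ t → g (suc t))
... | t₁ , t₁-min with g zero ≤? g (suc t₁)
...   | yes g0≤ = zero , λ { zero → ≤-refl ; (suc t) → ≤-trans g0≤ (t₁-min t) }
...   | no  g0≰ = suc t₁ , λ { zero → <⇒≤ (≰⇒> g0≰) ; (suc t) → t₁-min t }

least : (P : ℕ → Set) → (∀ t → Dec (P t)) → ∀ p → P p → Σ ℕ λ q → P q × (∀ t → t < q → ¬ P t)
least P P? = <-rec (λ p → P p → Σ ℕ λ q → P q × (∀ t → t < q → ¬ P t)) step
  where
  step : ∀ p → (∀ {q} → q < p → P q → Σ ℕ λ r → P r × (∀ t → t < r → ¬ P t)) →
         P p → Σ ℕ λ q → P q × (∀ t → t < q → ¬ P t)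
  step p smaller Pp with anyUpTo? P? p
  ... | yes (q , q<p , Pq) = smaller q<p Pq
  ... | no  none           = p , Pp , λ t t<p Pt → none (t , t<p , Pt)

flatten : ∀ {B : Set} {K} → List (Vec B K) → List B
flatten []       = []
flatten (v ∷ vs) = toList v ++ flatten vs

flatten-++ : ∀ {B : Set} {K} (vs ws : List (Vec B K)) → flatten (vs ++ ws) ≡ flatten vs ++ flatten ws
flatten-++ []       ws = refl
flatten-++ (v ∷ vs) ws = trans (cong (toList v ++_) (flatten-++ vs ws)) (sym (++-assoc (toList v) _ _))

length-flatten : ∀ {B : Set} {K} (vs : List (Vec B K)) → length (flatten vs) ≡ length vs * K
length-flatten []       = refl
length-flatten (v ∷ vs) = trans (length-++ (toList v)) (cong₂ _+_ (length-toList v) (length-flatten vs))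

All-toList⁻ : ∀ {B : Set} {P : B → Set} {K} (v : Vec B K) → All P (toList v) → ∀ j → P (lookup v j)
All-toList⁻ (x V.∷ v) (px ∷ pv) zero    = px
All-toList⁻ (x V.∷ v) (px ∷ pv) (suc j) = All-toList⁻ v pv j

All-flatten⁻ : ∀ {B : Set} {P : B → Set} {K} (vs : List (Vec B K)) → All P (flatten vs) →
               All (λ v → ∀ j → P (lookup v j)) vs
All-flatten⁻ []       _   = []
All-flatten⁻ (v ∷ vs) all = All-toList⁻ v (All.++⁻ˡ (toList v) all) ∷ All-flatten⁻ vs (All.++⁻ʳ (toList v) all)

singletons : ∀ {B : Set} → List B → List (Vec B 1)
singletons = L.map (λ x → x V.∷ V.[])

flatten-singletons : ∀ {B : Set} (xs : List B) → flatten (singletons xs) ≡ xs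
flatten-singletons []       = refl
flatten-singletons (x ∷ xs) = cong (x ∷_) (flatten-singletons xs)

record Blocks {B : Set} (K : ℕ) (xs : List B) : Set where
  field
    leftover : List B
    blocks   : List (Vec B K)
    split    : xs ≡ leftover ++ flatten blocks
    few      : length leftover < K

  length-split : length xs ≡ length leftover + length blocks * K
  length-split = trans (cong length split) (trans (length-++ leftover) (cong (length leftover +_) (length-flatten blocks)))

cut : ∀ {B : Set} K → 1 ≤ K → (xs : List B) → Blocks K xs
cut K 1≤K []       = record { leftover = [] ; blocks = [] ; split = refl ; few = 1≤K }
cut {B} K 1≤K (x ∷ xs) with cut K 1≤K xs
... | record { leftover = r ; blocks = bs ; split = xs≡ ; few = r<K } with suc (length r) <? K
...   | yes r+1<K = record { leftover = x ∷ r ; blocks = bs ; split = cong (x ∷_) xs≡ ; few = r+1<K }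
...   | no  r+1≮K = record { leftover = [] ; blocks = block ∷ bs ; split = x∷xs≡ ; few = 1≤K }
  where
  full : length (x ∷ r) ≡ K
  full = ≤-antisym r<K (≮⇒≥ r+1≮K)
  block : Vec B K
  block = subst (Vec B) full (V.fromList (x ∷ r))
  toList-block : toList block ≡ x ∷ r
  toList-block = trans (toList-subst full (V.fromList (x ∷ r))) (toList∘fromList (x ∷ r))
    where
    toList-subst : ∀ {L L′} (e : L ≡ L′) (v : Vec B L) → toList (subst (Vec B) e v) ≡ toList v
    toList-subst refl v = refl
  x∷xs≡ : x ∷ xs ≡ flatten (block ∷ bs)
  x∷xs≡ = trans (cong (x ∷_) xs≡) (cong (_++ flatten bs) (sym toList-block))

perm-injective : ∀ {n} (P : Permutation′ n) {x y} → P ⟨$⟩ʳ x ≡ P ⟨$⟩ʳ y → x ≡ y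
perm-injective P {x} {y} e = trans (sym (inverseˡ P)) (trans (cong (P ⟨$⟩ˡ_) e) (inverseˡ P))

hamming-conjugate : ∀ {n} (P π π′ : Permutation′ n) →
                    hamming (flip P ∘ₚ (π ∘ₚ P)) (flip P ∘ₚ (π′ ∘ₚ P)) ≡ hamming π π′
hamming-conjugate P π π′ = begin
    hamming (flip P ∘ₚ (π ∘ₚ P)) (flip P ∘ₚ (π′ ∘ₚ P))
  ≡⟨ hamming≡sum (flip P ∘ₚ (π ∘ₚ P)) (flip P ∘ₚ (π′ ∘ₚ P)) ⟩
    sum (λ i → mismatch (P ⟨$⟩ʳ (π ⟨$⟩ʳ (P ⟨$⟩ˡ i))) (P ⟨$⟩ʳ (π′ ⟨$⟩ʳ (P ⟨$⟩ˡ i))))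
  ≡⟨ sum-permute _ P ⟩
    sum (λ y → mismatch (P ⟨$⟩ʳ (π ⟨$⟩ʳ (P ⟨$⟩ˡ (P ⟨$⟩ʳ y)))) (P ⟨$⟩ʳ (π′ ⟨$⟩ʳ (P ⟨$⟩ˡ (P ⟨$⟩ʳ y)))))
  ≡⟨ sum-cong-≗ (λ y → trans (cong (λ z → mismatch (P ⟨$⟩ʳ (π ⟨$⟩ʳ z)) (P ⟨$⟩ʳ (π′ ⟨$⟩ʳ z))) (inverseˡ P))
                             (mismatch-injective (P ⟨$⟩ʳ_) (perm-injective P) (π ⟨$⟩ʳ y) (π′ ⟨$⟩ʳ y))) ⟩
    sum (λ y → mismatch (π ⟨$⟩ʳ y) (π′ ⟨$⟩ʳ y))
  ≡⟨ sym (hamming≡sum π π′) ⟩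
    hamming π π′ ∎
  where open ≡-Reasoning

injective⇒surjective : ∀ {N} (f : Fin N → Fin N) → (∀ {x y} → f x ≡ f y → x ≡ y) → ∀ x → ∃ λ y → f y ≡ x
injective⇒surjective {zero}  f f-inj ()
injective⇒surjective {suc N} f f-inj x with FP.any? (λ y → f y F.≟ x)
... | yes hit = hit
... | no miss = ⊥-elim (<-irrefl refl (FP.injective⇒≤ {f = squeeze} squeeze-injective))
  where
  -- Missing x, f factors through Fin N.
  x≢f : ∀ y → x ≢ f y
  x≢f y x≡fy = miss (y , sym x≡fy)
  squeeze : Fin (suc N) → Fin N
  squeeze y = F.punchOut (x≢f y)
  squeeze-injective : ∀ {a b} → squeeze a ≡ squeeze b → a ≡ b
  squeeze-injective {a} {b} e = f-inj (FP.punchOut-injective (x≢f a) (x≢f b) e)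

injective⇒permutation : ∀ {N} (f : Fin N → Fin N) → (∀ {x y} → f x ≡ f y → x ≡ y) → Permutation′ N
injective⇒permutation f f-inj =
  permutation f (λ x → proj₁ (onto x)) (λ x → proj₂ (onto x)) (λ y → f-inj (proj₂ (onto (f y))))
  where
  onto : ∀ x → ∃ λ y → f y ≡ x
  onto = injective⇒surjective f f-inj

-- Writing Fin (k * m) as k blocks of size m,
-- `diagonal τ` applies τ inside every block; conjugating by any P ∈ S_{km} gives an
-- isometric embedding τ ↦ P ∘ diagonal τ ∘ P⁻¹.

module Diagonal (k m : ℕ) where

  blockwise : (Fin m → Fin m) → Fin (k * m) → Fin (k * m)
  blockwise f y = combine (proj₁ (remQuot {k} m y)) (f (proj₂ (remQuot {k} m y)))

  blockwise-combine : ∀ f j a → blockwise f (combine j a) ≡ combine j (f a)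
  blockwise-combine f j a = cong (λ p → combine (proj₁ p) (f (proj₂ p))) (remQuot-combine {k} {m} j a)

  blockwise-inverse : ∀ f g → (∀ a → g (f a) ≡ a) → ∀ y → blockwise g (blockwise f y) ≡ y
  blockwise-inverse f g g∘f≡id y = begin
      blockwise g (blockwise f y)
    ≡⟨ blockwise-combine g j (f a) ⟩
      combine j (g (f a))
    ≡⟨ cong (combine j) (g∘f≡id a) ⟩
      combine j a
    ≡⟨ combine-remQuot {k} m y ⟩
      y ∎
    where
    open ≡-Reasoning
    j : Fin k
    j = proj₁ (remQuot {k} m y)
    a : Fin m
    a = proj₂ (remQuot {k} m y)

  diagonal : Permutation′ m → Permutation′ (k * m)
  diagonal τ = permutation (blockwise (τ ⟨$⟩ʳ_)) (blockwise (τ ⟨$⟩ˡ_))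
                 (blockwise-inverse (τ ⟨$⟩ˡ_) (τ ⟨$⟩ʳ_) (λ _ → inverseʳ τ))
                 (blockwise-inverse (τ ⟨$⟩ʳ_) (τ ⟨$⟩ˡ_) (λ _ → inverseˡ τ))

  -- Every block contributes the mismatches of σ and τ.
  hamming-diagonal : ∀ σ τ → hamming (diagonal σ) (diagonal τ) ≡ k * hamming σ τ
  hamming-diagonal σ τ = begin
      hamming (diagonal σ) (diagonal τ)
    ≡⟨ hamming≡sum (diagonal σ) (diagonal τ) ⟩
      sum (λ y → mismatch (blockwise (σ ⟨$⟩ʳ_) y) (blockwise (τ ⟨$⟩ʳ_) y))
    ≡⟨ sum-combine k _ ⟩
      sum {k} (λ j → sum {m} (λ a → mismatch (blockwise (σ ⟨$⟩ʳ_) (combine j a)) (blockwise (τ ⟨$⟩ʳ_) (combine j a))))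
    ≡⟨ sum-cong-≗ (λ j → sum-cong-≗ (λ a → in-block j a)) ⟩
      sum {k} (λ _ → sum {m} (λ a → mismatch (σ ⟨$⟩ʳ a) (τ ⟨$⟩ʳ a)))
    ≡⟨ trans (sum-const k _) (cong (k *_) (sym (hamming≡sum σ τ))) ⟩
      k * hamming σ τ ∎
    where
    open ≡-Reasoning
    in-block : ∀ j a → mismatch (blockwise (σ ⟨$⟩ʳ_) (combine j a)) (blockwise (τ ⟨$⟩ʳ_) (combine j a))
                       ≡ mismatch (σ ⟨$⟩ʳ a) (τ ⟨$⟩ʳ a)
    in-block j a = trans (cong₂ mismatch (blockwise-combine (σ ⟨$⟩ʳ_) j a) (blockwise-combine (τ ⟨$⟩ʳ_) j a))
                         (mismatch-injective (combine j) (λ {x} {y} → combine-injectiveʳ j x j y) (σ ⟨$⟩ʳ a) (τ ⟨$⟩ʳ a))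

  conjugate : Permutation′ (k * m) → Permutation′ m → Permutation′ (k * m)
  conjugate P τ = flip P ∘ₚ (diagonal τ ∘ₚ P)

  -- Injectivity reads off the block j₀, which needs k ≥ 1.
  conjugate-isometric : Fin k → (P : Permutation′ (k * m)) → IsIsometricEmbedding (conjugate P)
  conjugate-isometric j₀ P = respects-≈ , homomorphic , injective , isometric
    where
    respects-≈ : ∀ σ τ → σ ≈ τ → conjugate P σ ≈ conjugate P τ
    respects-≈ σ τ σ≈τ i = cong (P ⟨$⟩ʳ_) (cong (combine {k} {m} _) (σ≈τ _))

    homomorphic : ∀ σ τ → conjugate P (σ ∘ₚ τ) ≈ (conjugate P σ ∘ₚ conjugate P τ)
    homomorphic σ τ i = cong (P ⟨$⟩ʳ_) (begin
        combine j (τ ⟨$⟩ʳ (σ ⟨$⟩ʳ a))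
      ≡⟨ sym (blockwise-combine (τ ⟨$⟩ʳ_) j (σ ⟨$⟩ʳ a)) ⟩
        blockwise (τ ⟨$⟩ʳ_) (combine j (σ ⟨$⟩ʳ a))
      ≡⟨ cong (blockwise (τ ⟨$⟩ʳ_)) (sym (inverseˡ P)) ⟩
        blockwise (τ ⟨$⟩ʳ_) (P ⟨$⟩ˡ (P ⟨$⟩ʳ combine j (σ ⟨$⟩ʳ a))) ∎)
      where
      open ≡-Reasoning
      j : Fin k
      j = proj₁ (remQuot {k} m (P ⟨$⟩ˡ i))
      a : Fin m
      a = proj₂ (remQuot {k} m (P ⟨$⟩ˡ i))

    injective : ∀ σ τ → conjugate P σ ≈ conjugate P τ → σ ≈ τ
    injective σ τ eq a = combine-injectiveʳ j₀ (σ ⟨$⟩ʳ a) j₀ (τ ⟨$⟩ʳ a) (begin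
        combine j₀ (σ ⟨$⟩ʳ a)
      ≡⟨ sym (blockwise-combine (σ ⟨$⟩ʳ_) j₀ a) ⟩
        blockwise (σ ⟨$⟩ʳ_) (combine j₀ a)
      ≡⟨ perm-injective P at-block ⟩
        blockwise (τ ⟨$⟩ʳ_) (combine j₀ a)
      ≡⟨ blockwise-combine (τ ⟨$⟩ʳ_) j₀ a ⟩
        combine j₀ (τ ⟨$⟩ʳ a) ∎)
      where
      open ≡-Reasoning
      at-block : P ⟨$⟩ʳ blockwise (σ ⟨$⟩ʳ_) (combine j₀ a) ≡ P ⟨$⟩ʳ blockwise (τ ⟨$⟩ʳ_) (combine j₀ a)
      at-block = subst (λ z → P ⟨$⟩ʳ blockwise (σ ⟨$⟩ʳ_) z ≡ P ⟨$⟩ʳ blockwise (τ ⟨$⟩ʳ_) z)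
                       (inverseˡ P) (eq (P ⟨$⟩ʳ combine j₀ a))

    isometric : ∀ σ τ → hamming (conjugate P σ) (conjugate P τ) * m ≡ hamming σ τ * (k * m)
    isometric σ τ = begin
        hamming (conjugate P σ) (conjugate P τ) * m
      ≡⟨ cong (_* m) (trans (hamming-conjugate P (diagonal σ) (diagonal τ)) (hamming-diagonal σ τ)) ⟩
        k * hamming σ τ * m
      ≡⟨ *-assoc k _ m ⟩
        k * (hamming σ τ * m)
      ≡⟨ cong (k *_) (*-comm (hamming σ τ) m) ⟩
        k * (m * hamming σ τ)
      ≡⟨ sym (*-assoc k m _) ⟩
        k * m * hamming σ τ
      ≡⟨ *-comm (k * m) _ ⟩
        hamming σ τ * (k * m) ∎
      where open ≡-Reasoning

-- A bundle (l , W) is a k-tuple W of sequences of l + 1 points of Fin n.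
-- A list G of bundles describes the permutation `cyclic G` of Fin (size G), the
-- disjoint union of one (l+1)-cycle per bundle, and the labelling
-- `label G j` : Fin (size G) → Fin n which reads the j-th sequences of the bundles.
-- Transported along the labels, `cyclic G` moves every point of every sequence to
-- the next point of its sequence (cyclically).  Its cost counts the steps where
-- this disagrees with σ.

module Bundles {n : ℕ} (k : ℕ) (σ : Permutation′ n) where

  Bundle : Set
  Bundle = Σ ℕ λ l → Vec (Vec (Fin n) (suc l)) k

  size : List Bundle → ℕ
  size []            = 0
  size ((l , W) ∷ G) = suc l + size G

  cyclic : (G : List Bundle) → Fin (size G) → Fin (size G)
  cyclic []            = λ ()
  cyclic ((l , W) ∷ G) = rotate ⊕ cyclic G

  cyclic⁻¹ : (G : List Bundle) → Fin (size G) → Fin (size G)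
  cyclic⁻¹ []            = λ ()
  cyclic⁻¹ ((l , W) ∷ G) = rotate⁻¹ ⊕ cyclic⁻¹ G

  cyclicPerm : (G : List Bundle) → Permutation′ (size G)
  cyclicPerm G = permutation (cyclic G) (cyclic⁻¹ G) (inverse₁ G) (inverse₂ G)
    where
    inverse₁ : ∀ G x → cyclic G (cyclic⁻¹ G x) ≡ x
    inverse₁ []            ()
    inverse₁ ((l , W) ∷ G) = ⊕-inverse rotate⁻¹ (cyclic⁻¹ G) rotate (cyclic G) rotate-rotate⁻¹ (inverse₁ G)
    inverse₂ : ∀ G x → cyclic⁻¹ G (cyclic G x) ≡ x
    inverse₂ []            ()
    inverse₂ ((l , W) ∷ G) = ⊕-inverse rotate (cyclic G) rotate⁻¹ (cyclic⁻¹ G) rotate⁻¹-rotate (inverse₂ G)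

  label : (G : List Bundle) → Fin k → Fin (size G) → Fin n
  label []            j = λ ()
  label ((l , W) ∷ G) j x = [ lookup (lookup W j) , label G j ]′ (splitAt (suc l) x)

  label-↑ˡ : ∀ l W G j (t : Fin (suc l)) → label ((l , W) ∷ G) j (t ↑ˡ size G) ≡ lookup (lookup W j) t
  label-↑ˡ l W G j t rewrite splitAt-↑ˡ (suc l) t (size G) = refl

  label-↑ʳ : ∀ l W G j (u : Fin (size G)) → label ((l , W) ∷ G) j (suc l ↑ʳ u) ≡ label G j u
  label-↑ʳ l W G j u rewrite splitAt-↑ʳ (suc l) (size G) u = refl

  cyclic-returns : ∀ c (G : List Bundle) → All (λ g → suc (proj₁ g) ≤ c) G →
                   ∀ a → Σ ℕ λ l → 1 ≤ l × l ≤ c × pow (cyclicPerm G) l a ≡ a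
  cyclic-returns c ((l , W) ∷ G) (l<c ∷ G≤c) x with splitView (suc l) (size G) x
  ... | left t = suc l , s≤s z≤n , l<c , (begin
      pow (cyclicPerm ((l , W) ∷ G)) (suc l) (t ↑ˡ size G)   ≡⟨ pow≡iter (cyclicPerm ((l , W) ∷ G)) (suc l) _ ⟩
      iter (rotate ⊕ cyclic G) (suc l) (t ↑ˡ size G)         ≡⟨ iter-⊕-↑ˡ rotate (cyclic G) (suc l) t ⟩
      iter rotate (suc l) t ↑ˡ size G                         ≡⟨ cong (_↑ˡ size G) (rotate-period t) ⟩
      t ↑ˡ size G                                             ∎)
    where open ≡-Reasoning
  ... | right u with cyclic-returns c G G≤c u
  ...   | l′ , 1≤l′ , l′≤c , returns = l′ , 1≤l′ , l′≤c , (begin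
      pow (cyclicPerm ((l , W) ∷ G)) l′ (suc l ↑ʳ u)   ≡⟨ pow≡iter (cyclicPerm ((l , W) ∷ G)) l′ _ ⟩
      iter (rotate ⊕ cyclic G) l′ (suc l ↑ʳ u)         ≡⟨ iter-⊕-↑ʳ rotate (cyclic G) l′ u ⟩
      suc l ↑ʳ iter (cyclic G) l′ u                    ≡⟨ cong (suc l ↑ʳ_) (sym (pow≡iter (cyclicPerm G) l′ u)) ⟩
      suc l ↑ʳ pow (cyclicPerm G) l′ u                 ≡⟨ cong (suc l ↑ʳ_) returns ⟩
      suc l ↑ʳ u                                       ∎)
    where open ≡-Reasoning

  KeepsFixedPoints : Bundle → Set
  KeepsFixedPoints (l , W) = ∀ j t → σ ⟨$⟩ʳ lookup (lookup W j) t ≡ lookup (lookup W j) t → l ≡ 0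

  cyclic-fixes : ∀ (G : List Bundle) → All KeepsFixedPoints G →
                 ∀ j a → σ ⟨$⟩ʳ label G j a ≡ label G j a → cyclic G a ≡ a
  cyclic-fixes ((l , W) ∷ G) (keeps ∷ G-keeps) j x fixed with splitView (suc l) (size G) x
  ... | left t with keeps j t (subst (λ z → σ ⟨$⟩ʳ z ≡ z) (label-↑ˡ l W G j t) fixed)
  ...   | refl = trans (⊕-↑ˡ rotate (cyclic G) t) (cong (_↑ˡ size G) (rotate-one t))
    where
    rotate-one : (t : Fin 1) → rotate t ≡ t
    rotate-one zero = refl
  cyclic-fixes ((l , W) ∷ G) (keeps ∷ G-keeps) j x fixed | right u =
    trans (⊕-↑ʳ rotate (cyclic G) u)
          (cong (suc l ↑ʳ_) (cyclic-fixes G G-keeps j u (subst (λ z → σ ⟨$⟩ʳ z ≡ z) (label-↑ʳ l W G j u) fixed)))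

  -- Steps of the closed sequence v (last point back to the first) not made by σ.
  seqCost : ∀ {l} → Vec (Fin n) (suc l) → ℕ
  seqCost v = sum (λ t → mismatch (lookup v (rotate t)) (σ ⟨$⟩ʳ lookup v t))

  cost : List Bundle → ℕ
  cost []            = 0
  cost ((l , W) ∷ G) = sum {k} (λ j → seqCost (lookup W j)) + cost G

  label-mismatches : ∀ G → sum {k} (λ j → sum (λ a → mismatch (label G j (cyclic G a)) (σ ⟨$⟩ʳ label G j a)))
                           ≡ cost G
  label-mismatches []            = trans (sum-const k 0) (*-zeroʳ k)
  label-mismatches ((l , W) ∷ G) = begin
      sum (λ j → sum (μ j))
    ≡⟨ sum-cong-≗ (λ j → sum-++ (suc l) (μ j)) ⟩
      sum (λ j → sum (λ t → μ j (t ↑ˡ size G)) + sum (λ u → μ j (suc l ↑ʳ u)))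
    ≡⟨ sum-+ (λ j → sum (λ t → μ j (t ↑ˡ size G))) (λ j → sum (λ u → μ j (suc l ↑ʳ u))) ⟩
      sum (λ j → sum (λ t → μ j (t ↑ˡ size G))) + sum (λ j → sum (λ u → μ j (suc l ↑ʳ u)))
    ≡⟨ cong₂ _+_ (sum-cong-≗ (λ j → sum-cong-≗ (in-first j)))
                 (trans (sum-cong-≗ (λ j → sum-cong-≗ (in-rest j))) (label-mismatches G)) ⟩
      cost ((l , W) ∷ G) ∎
    where
    open ≡-Reasoning
    μ : Fin k → Fin (suc l + size G) → ℕ
    μ j a = mismatch (label ((l , W) ∷ G) j (cyclic ((l , W) ∷ G) a)) (σ ⟨$⟩ʳ label ((l , W) ∷ G) j a)
    in-first : ∀ j t → μ j (t ↑ˡ size G) ≡ mismatch (lookup (lookup W j) (rotate t)) (σ ⟨$⟩ʳ lookup (lookup W j) t)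
    in-first j t = cong₂ mismatch
      (trans (cong (label ((l , W) ∷ G) j) (⊕-↑ˡ rotate (cyclic G) t)) (label-↑ˡ l W G j (rotate t)))
      (cong (σ ⟨$⟩ʳ_) (label-↑ˡ l W G j t))
    in-rest : ∀ j u → μ j (suc l ↑ʳ u) ≡ mismatch (label G j (cyclic G u)) (σ ⟨$⟩ʳ label G j u)
    in-rest j u = cong₂ mismatch
      (trans (cong (label ((l , W) ∷ G) j) (⊕-↑ʳ rotate (cyclic G) u)) (label-↑ʳ l W G j (cyclic G u)))
      (cong (σ ⟨$⟩ʳ_) (label-↑ʳ l W G j u))

  bundlePoints : ∀ {L k′} → Vec (Vec (Fin n) L) k′ → List (Fin n)
  bundlePoints V.[]       = []
  bundlePoints (w V.∷ W) = toList w ++ bundlePoints W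

  points : List Bundle → List (Fin n)
  points []            = []
  points ((l , W) ∷ G) = bundlePoints W ++ points G

  lookup∈bundlePoints : ∀ {L k′} (W : Vec (Vec (Fin n) L) k′) j t → lookup (lookup W j) t ∈ bundlePoints W
  lookup∈bundlePoints (w V.∷ W) zero    t = ∈-++⁺ˡ (lookup∈toList w t)
  lookup∈bundlePoints (w V.∷ W) (suc j) t = ∈-++⁺ʳ (toList w) (lookup∈bundlePoints W j t)

  label∈points : ∀ G j a → label G j a ∈ points G
  label∈points ((l , W) ∷ G) j x with splitView (suc l) (size G) x
  ... | left t  = subst (_∈ points ((l , W) ∷ G)) (sym (label-↑ˡ l W G j t)) (∈-++⁺ˡ (lookup∈bundlePoints W j t))
  ... | right u = subst (_∈ points ((l , W) ∷ G)) (sym (label-↑ʳ l W G j u)) (∈-++⁺ʳ (bundlePoints W) (label∈points G j u))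

  lookup-injective : ∀ {L k′} (W : Vec (Vec (Fin n) L) k′) → Unique (bundlePoints W) → ∀ {j t j′ t′} →
                     lookup (lookup W j) t ≡ lookup (lookup W j′) t′ → j ≡ j′ × t ≡ t′
  lookup-injective (w V.∷ W) u {zero} {t} {zero} {t′} e =
    refl , unique⇒lookup-injective w (proj₁ (unique-++⁻ (toList w) u)) e
  lookup-injective (w V.∷ W) u {zero} {t} {suc j′} {t′} e =
    ⊥-elim (proj₂ (proj₂ (unique-++⁻ (toList w) u)) (lookup∈toList w t)
                  (subst (_∈ bundlePoints W) (sym e) (lookup∈bundlePoints W j′ t′)))
  lookup-injective (w V.∷ W) u {suc j} {t} {zero} {t′} e =
    ⊥-elim (proj₂ (proj₂ (unique-++⁻ (toList w) u)) (lookup∈toList w t′)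
                  (subst (_∈ bundlePoints W) e (lookup∈bundlePoints W j t)))
  lookup-injective (w V.∷ W) u {suc j} {t} {suc j′} {t′} e with lookup-injective W (proj₁ (proj₂ (unique-++⁻ (toList w) u))) e
  ... | j≡j′ , t≡t′ = cong suc j≡j′ , t≡t′

  label-injective : ∀ G → Unique (points G) → ∀ {j a j′ a′} → label G j a ≡ label G j′ a′ → j ≡ j′ × a ≡ a′
  label-injective ((l , W) ∷ G) u {j} {x} {j′} {x′} e
    with unique-++⁻ (bundlePoints W) u | splitView (suc l) (size G) x | splitView (suc l) (size G) x′
  ... | u-W , u-G , disjoint | left t | left t′
    with lookup-injective W u-W (trans (sym (label-↑ˡ l W G j t)) (trans e (label-↑ˡ l W G j′ t′)))
  ...   | j≡j′ , t≡t′ = j≡j′ , cong (_↑ˡ size G) t≡t′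
  label-injective ((l , W) ∷ G) u {j} {x} {j′} {x′} e | u-W , u-G , disjoint | left t | right v′ =
    ⊥-elim (disjoint (lookup∈bundlePoints W j t)
      (subst (_∈ points G) (trans (sym (label-↑ʳ l W G j′ v′)) (trans (sym e) (label-↑ˡ l W G j t))) (label∈points G j′ v′)))
  label-injective ((l , W) ∷ G) u {j} {x} {j′} {x′} e | u-W , u-G , disjoint | right v | left t′ =
    ⊥-elim (disjoint (lookup∈bundlePoints W j′ t′)
      (subst (_∈ points G) (trans (sym (label-↑ʳ l W G j v)) (trans e (label-↑ˡ l W G j′ t′))) (label∈points G j v)))
  label-injective ((l , W) ∷ G) u {j} {x} {j′} {x′} e | u-W , u-G , disjoint | right v | right v′
    with label-injective G u-G (trans (sym (label-↑ʳ l W G j v)) (trans e (label-↑ʳ l W G j′ v′)))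
  ... | j≡j′ , v≡v′ = j≡j′ , cong (suc l ↑ʳ_) v≡v′

-- An injective labelling Fin k × Fin m → Fin (k * m)
-- is a bijection and so defines P ∈ S_{km}; the image ρ of ρ̃ ∈ S_m under the
-- isometric embedding `conjugate P` acts on labels as ρ̃ acts on positions.

module Transport (k m : ℕ) (σ : Permutation′ (k * m)) (ρ̃ : Permutation′ m)
                 (lab : Fin k → Fin m → Fin (k * m))
                 (lab-injective : ∀ {j a j′ a′} → lab j a ≡ lab j′ a′ → j ≡ j′ × a ≡ a′) where
  open Diagonal k m

  labelling : Fin (k * m) → Fin (k * m)
  labelling y = lab (proj₁ (remQuot {k} m y)) (proj₂ (remQuot {k} m y))

  labelling-combine : ∀ j a → labelling (combine j a) ≡ lab j a
  labelling-combine j a = cong (λ p → lab (proj₁ p) (proj₂ p)) (remQuot-combine {k} {m} j a)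

  labelling-injective : ∀ {x y} → labelling x ≡ labelling y → x ≡ y
  labelling-injective {x} {y} e with lab-injective e
  ... | j≡j′ , a≡a′ = trans (sym (combine-remQuot {k} m x)) (trans (cong₂ combine j≡j′ a≡a′) (combine-remQuot {k} m y))

  P : Permutation′ (k * m)
  P = injective⇒permutation labelling labelling-injective

  ρ : Permutation′ (k * m)
  ρ = conjugate P ρ̃

  ρ-lab : ∀ j a → ρ ⟨$⟩ʳ lab j a ≡ lab j (ρ̃ ⟨$⟩ʳ a)
  ρ-lab j a = begin
      P ⟨$⟩ʳ blockwise (ρ̃ ⟨$⟩ʳ_) (P ⟨$⟩ˡ lab j a)
    ≡⟨ cong (λ z → P ⟨$⟩ʳ blockwise (ρ̃ ⟨$⟩ʳ_) (P ⟨$⟩ˡ z)) (sym (labelling-combine j a)) ⟩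
      P ⟨$⟩ʳ blockwise (ρ̃ ⟨$⟩ʳ_) (P ⟨$⟩ˡ (P ⟨$⟩ʳ combine j a))
    ≡⟨ cong (λ z → P ⟨$⟩ʳ blockwise (ρ̃ ⟨$⟩ʳ_) z) (inverseˡ P) ⟩
      P ⟨$⟩ʳ blockwise (ρ̃ ⟨$⟩ʳ_) (combine j a)
    ≡⟨ cong (P ⟨$⟩ʳ_) (blockwise-combine (ρ̃ ⟨$⟩ʳ_) j a) ⟩
      labelling (combine j (ρ̃ ⟨$⟩ʳ a))
    ≡⟨ labelling-combine j _ ⟩
      lab j (ρ̃ ⟨$⟩ʳ a) ∎
    where open ≡-Reasoning

  pow-ρ-lab : ∀ s j a → pow ρ s (lab j a) ≡ lab j (pow ρ̃ s a)
  pow-ρ-lab zero    j a = refl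
  pow-ρ-lab (suc s) j a = trans (cong (ρ ⟨$⟩ʳ_) (pow-ρ-lab s j a)) (ρ-lab j _)

  lab-surjective : ∀ x → Σ (Fin k) λ j → Σ (Fin m) λ a → lab j a ≡ x
  lab-surjective x = proj₁ (remQuot {k} m (P ⟨$⟩ˡ x)) , proj₂ (remQuot {k} m (P ⟨$⟩ˡ x)) , inverseʳ P

  ρ-keeps-fixed : (∀ j a → σ ⟨$⟩ʳ lab j a ≡ lab j a → ρ̃ ⟨$⟩ʳ a ≡ a) → FixedPointsSup ρ σ
  ρ-keeps-fixed keeps x fixed with lab-surjective x
  ... | j , a , refl = trans (ρ-lab j a) (cong (lab j) (keeps j a fixed))

  -- A point on an l-cycle of ρ returns after any number l′ ≥ 1 of steps; by
  -- minimality of l, l ≤ l′.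
  ρ-cycles : (c : ℕ) → (∀ a → Σ ℕ λ l → 1 ≤ l × l ≤ c × pow ρ̃ l a ≡ a) → MaxCycleLen≤ ρ c
  ρ-cycles c returns l (x , 1≤l , _ , minimal) with lab-surjective x
  ... | j , a , refl with returns a
  ... | l′ , 1≤l′ , l′≤c , back with l ≤? l′
  ...   | yes l≤l′ = ≤-trans l≤l′ l′≤c
  ...   | no  l≰l′ = ⊥-elim (minimal l′ 1≤l′ (≰⇒> l≰l′) (trans (pow-ρ-lab l′ j a) (cong (lab j) back)))

  hamming-ρ : hamming ρ σ ≡ sum {k} (λ j → sum {m} (λ a → mismatch (lab j (ρ̃ ⟨$⟩ʳ a)) (σ ⟨$⟩ʳ lab j a)))
  hamming-ρ = begin
      hamming ρ σ
    ≡⟨ hamming≡sum ρ σ ⟩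
      sum (λ x → mismatch (ρ ⟨$⟩ʳ x) (σ ⟨$⟩ʳ x))
    ≡⟨ sum-permute _ P ⟩
      sum (λ y → mismatch (ρ ⟨$⟩ʳ labelling y) (σ ⟨$⟩ʳ labelling y))
    ≡⟨ sum-combine k _ ⟩
      sum {k} (λ j → sum {m} (λ a → mismatch (ρ ⟨$⟩ʳ labelling (combine j a)) (σ ⟨$⟩ʳ labelling (combine j a))))
    ≡⟨ sum-cong-≗ (λ j → sum-cong-≗ (λ a → at-label j a)) ⟩
      sum {k} (λ j → sum {m} (λ a → mismatch (lab j (ρ̃ ⟨$⟩ʳ a)) (σ ⟨$⟩ʳ lab j a))) ∎
    where
    open ≡-Reasoning
    at-label : ∀ j a → mismatch (ρ ⟨$⟩ʳ labelling (combine j a)) (σ ⟨$⟩ʳ labelling (combine j a))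
                       ≡ mismatch (lab j (ρ̃ ⟨$⟩ʳ a)) (σ ⟨$⟩ʳ lab j a)
    at-label j a rewrite labelling-combine j a = cong (λ z → mismatch z (σ ⟨$⟩ʳ lab j a)) (ρ-lab j a)

Approximation : (k m : ℕ) → Permutation′ (k * m) → ℕ → (ℕ → Set) → Set
Approximation k m σ c Close = Σ (Permutation′ (k * m)) λ ρ →
  FixedPointsSup ρ σ ×
  MaxCycleLen≤ ρ c ×
  Close (hamming ρ σ) ×
  (Σ (Permutation′ m) λ ρ̃ → Σ (Permutation′ m → Permutation′ (k * m)) λ Φ →
    IsIsometricEmbedding Φ × (ρ ≈ Φ ρ̃))

approximation-weaken : ∀ {k m σ c} {Close Close′ : ℕ → Set} → (∀ h → Close h → Close′ h) →
                       Approximation k m σ c Close → Approximation k m σ c Close′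
approximation-weaken weaken (ρ , fixes , cycles , close , embedded) = ρ , fixes , cycles , weaken _ close , embedded

labelled-approximation :
  ∀ k {m M} → Fin k → M ≡ m → (σ : Permutation′ (k * m)) (c : ℕ) (ρ̃ : Permutation′ M)
  (lab : Fin k → Fin M → Fin (k * m)) → (∀ {j a j′ a′} → lab j a ≡ lab j′ a′ → j ≡ j′ × a ≡ a′) →
  (∀ j a → σ ⟨$⟩ʳ lab j a ≡ lab j a → ρ̃ ⟨$⟩ʳ a ≡ a) →
  (∀ a → Σ ℕ λ l → 1 ≤ l × l ≤ c × pow ρ̃ l a ≡ a) →
  Approximation k m σ c (_≤ sum {k} (λ j → sum {M} (λ a → mismatch (lab j (ρ̃ ⟨$⟩ʳ a)) (σ ⟨$⟩ʳ lab j a))))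
labelled-approximation k {m} j₀ refl σ c ρ̃ lab lab-injective keeps returns =
  ρ , ρ-keeps-fixed keeps , ρ-cycles c returns , ≤-reflexive hamming-ρ ,
  ρ̃ , conjugate P , conjugate-isometric j₀ P , (λ _ → refl)
  where
  open Transport k m σ ρ̃ lab lab-injective
  open Diagonal k m

realise : ∀ k {m} → Fin k → (σ : Permutation′ (k * m)) (c : ℕ) → (G : List (Bundles.Bundle k σ)) →
          Bundles.size k σ G ≡ m → Unique (Bundles.points k σ G) →
          All (Bundles.KeepsFixedPoints k σ) G → All (λ g → suc (proj₁ g) ≤ c) G →
          Approximation k m σ c (_≤ Bundles.cost k σ G)
realise k j₀ σ c G size≡m unique keeps short =
  subst (λ B → Approximation k _ σ c (_≤ B)) (label-mismatches G)
        (labelled-approximation k j₀ size≡m σ c (cyclicPerm G) (label G) (label-injective G unique)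
                                (cyclic-fixes G keeps) (cyclic-returns c G short))
  where open Bundles k σ

-- Cycles.  A cycle of length l + 1 is listed as the sequence of its points; σ maps
-- every point of the sequence to the next one (and the last one to the first).

Cycle : ℕ → Set
Cycle n = Σ ℕ λ l → Vec (Fin n) (suc l)

cyclePoints : ∀ {n} → List (Cycle n) → List (Fin n)
cyclePoints []            = []
cyclePoints ((l , v) ∷ C) = toList v ++ cyclePoints C

IsCycle : ∀ {n} → Permutation′ n → Cycle n → Set
IsCycle σ (l , v) = (∀ t → σ ⟨$⟩ʳ lookup v t ≡ lookup v (rotate t)) ×
                    (1 ≤ l → ∀ t → σ ⟨$⟩ʳ lookup v t ≢ lookup v t)

-- The cycle decomposition of σ.  The orbit of x is x, s x, …, s^(top x) x with
-- s^(top x + 1) x = x; an orbit is listed once, starting from its least point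
-- (its leader).

module Orbits {n : ℕ} (σ : Permutation′ n) where

  s : Fin n → Fin n
  s x = σ ⟨$⟩ʳ x

  iter-injective : ∀ t {x y} → iter s t x ≡ iter s t y → x ≡ y
  iter-injective zero    e = e
  iter-injective (suc t) e = iter-injective t (perm-injective σ e)

  cancel : ∀ {a b} x → a ≤ b → iter s a x ≡ iter s b x → iter s (b ∸ a) x ≡ x
  cancel {a} {b} x a≤b e = iter-injective a (begin
      iter s a (iter s (b ∸ a) x)   ≡⟨ sym (iter-+ s a (b ∸ a) x) ⟩
      iter s (a + (b ∸ a)) x        ≡⟨ cong (λ z → iter s z x) (m+[n∸m]≡n a≤b) ⟩
      iter s b x                    ≡⟨ sym e ⟩
      iter s a x                    ∎)
    where open ≡-Reasoning

  Returns : Fin n → ℕ → Set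
  Returns x t = 1 ≤ t × iter s t x ≡ x

  returns? : ∀ x t → Dec (Returns x t)
  returns? x t with 1 ≤? t | iter s t x F.≟ x
  ... | yes 1≤t | yes back = yes (1≤t , back)
  ... | no  1≰t | _        = no (λ r → 1≰t (proj₁ r))
  ... | _       | no  ¬back = no (λ r → ¬back (proj₂ r))

  -- Two of x, s x, …, s^n x coincide, so x returns.
  returns : ∀ x → Σ ℕ (Returns x)
  returns x with FP.pigeonhole (n<1+n n) (λ (i : Fin (suc n)) → iter s (toℕ i) x)
  ... | i , j , i<j , e = toℕ j ∸ toℕ i , m<n⇒0<n∸m i<j , cancel x (<⇒≤ i<j) e

  -- The least period, kept abstract so that the search is never unfolded; only the
  -- properties below are used.
  abstract
    period : ∀ x → Σ ℕ λ q → Returns x q × (∀ t → t < q → ¬ Returns x t)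
    period x = least (Returns x) (returns? x) (proj₁ (returns x)) (proj₂ (returns x))

    top : Fin n → ℕ
    top x = proj₁ (period x) ∸ 1

    suc-top : ∀ x → suc (top x) ≡ proj₁ (period x)
    suc-top x with period x
    ... | suc q , _        = refl
    ... | zero  , (() , _) , _

    top-returns : ∀ x → iter s (suc (top x)) x ≡ x
    top-returns x = subst (λ z → iter s z x ≡ x) (sym (suc-top x)) (proj₂ (proj₁ (proj₂ (period x))))

    top-minimal : ∀ x t → 1 ≤ t → t ≤ top x → iter s t x ≢ x
    top-minimal x t 1≤t t≤top e = proj₂ (proj₂ (period x)) t (subst (t <_) (suc-top x) (s≤s t≤top)) (1≤t , e)

  orbit-distinct : ∀ x {t t′} → t < t′ → t′ ≤ top x → iter s t x ≢ iter s t′ x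
  orbit-distinct x {t} {t′} t<t′ t′≤top e =
    top-minimal x (t′ ∸ t) (m<n⇒0<n∸m t<t′) (≤-trans (m∸n≤m t′ t) t′≤top) (cancel x (<⇒≤ t<t′) e)

  orbit-reduce : ∀ x u → Σ ℕ λ t → t ≤ top x × iter s u x ≡ iter s t x
  orbit-reduce x zero    = zero , z≤n , refl
  orbit-reduce x (suc u) with orbit-reduce x u
  ... | t , t≤top , e with m≤n⇒m<n∨m≡n t≤top
  ...   | inj₁ t<top = suc t , t<top , cong s e
  ...   | inj₂ refl  = zero , z≤n , trans (cong s e) (top-returns x)

  orbit-back : ∀ x t → Σ ℕ λ u → iter s u (iter s t x) ≡ x
  orbit-back x t with orbit-reduce x t
  ... | t′ , t′≤top , e = suc (top x) ∸ t′ , (begin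
      iter s (suc (top x) ∸ t′) (iter s t x)    ≡⟨ cong (iter s (suc (top x) ∸ t′)) e ⟩
      iter s (suc (top x) ∸ t′) (iter s t′ x)   ≡⟨ sym (iter-+ s (suc (top x) ∸ t′) t′ x) ⟩
      iter s (suc (top x) ∸ t′ + t′) x          ≡⟨ cong (λ z → iter s z x) (m∸n+n≡m (m≤n⇒m≤1+n t′≤top)) ⟩
      iter s (suc (top x)) x                    ≡⟨ top-returns x ⟩
      x                                         ∎)
    where open ≡-Reasoning

  Leader : Fin n → Set
  Leader x = ∀ (t : Fin (suc (top x))) → toℕ x ≤ toℕ (iter s (toℕ t) x)

  leader? : ∀ x → Dec (Leader x)
  leader? x = FP.all? (λ t → toℕ x ≤? toℕ (iter s (toℕ t) x))

  leader-least : ∀ x → Leader x → ∀ u → toℕ x ≤ toℕ (iter s u x)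
  leader-least x leader u with orbit-reduce x u
  ... | t , t≤top , e = subst (λ z → toℕ x ≤ toℕ z) (sym e)
        (subst (λ z → toℕ x ≤ toℕ (iter s z x)) (toℕ-fromℕ< (s≤s t≤top)) (leader (F.fromℕ< (s≤s t≤top))))

  -- Two leaders of intersecting orbits are each ≤ the other, hence equal.
  leader-unique : ∀ x x′ → Leader x → Leader x′ → ∀ t t′ → iter s t x ≡ iter s t′ x′ → x ≡ x′
  leader-unique x x′ leader leader′ t t′ e =
    toℕ-injective (≤-antisym (reach x x′ leader t t′ e) (reach x′ x leader′ t′ t (sym e)))
    where
    reach : ∀ x x′ → Leader x → ∀ t t′ → iter s t x ≡ iter s t′ x′ → toℕ x ≤ toℕ x′
    reach x x′ leader t t′ e with orbit-back x′ t′
    ... | u , back = subst (λ z → toℕ x ≤ toℕ z) (trans (cong (iter s u) e) back)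
                           (subst (λ z → toℕ x ≤ toℕ z) (iter-+ s u t x) (leader-least x leader (u + t)))

  orbit : ∀ x → Vec (Fin n) (suc (top x))
  orbit x = V.tabulate (λ t → iter s (toℕ t) x)

  lookup-orbit : ∀ x (t : Fin (suc (top x))) → lookup (orbit x) t ≡ iter s (toℕ t) x
  lookup-orbit x t = lookup∘tabulate (λ t → iter s (toℕ t) x) t

  orbit-unique : ∀ x → Unique (toList (orbit x))
  orbit-unique x = lookup-injective⇒unique (orbit x) λ {t} {t′} e →
    toℕ-injective (same-index t t′ (trans (sym (lookup-orbit x t)) (trans e (lookup-orbit x t′))))
    where
    same-index : ∀ (t t′ : Fin (suc (top x))) → iter s (toℕ t) x ≡ iter s (toℕ t′) x → toℕ t ≡ toℕ t′
    same-index t t′ e with <-cmp (toℕ t) (toℕ t′)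
    ... | tri< t<t′ _ _ = ⊥-elim (orbit-distinct x t<t′ (≤-pred (toℕ<n t′)) e)
    ... | tri≈ _ t≡t′ _ = t≡t′
    ... | tri> _ _ t′<t = ⊥-elim (orbit-distinct x t′<t (≤-pred (toℕ<n t)) (sym e))

  orbit-isCycle : ∀ x → IsCycle σ (top x , orbit x)
  orbit-isCycle x = steps , moves
    where
    -- Split on the last position by hand: a `with` would also rewrite `rotate t`.
    steps : ∀ t → s (lookup (orbit x) t) ≡ lookup (orbit x) (rotate t)
    steps t = by-position (toℕ t ≟ top x)
      where
      by-position : Dec (toℕ t ≡ top x) → s (lookup (orbit x) t) ≡ lookup (orbit x) (rotate t)
      by-position (yes t≡top) = begin
          s (lookup (orbit x) t)          ≡⟨ cong s (lookup-orbit x t) ⟩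
          iter s (suc (toℕ t)) x          ≡⟨ cong (λ z → iter s (suc z) x) t≡top ⟩
          iter s (suc (top x)) x          ≡⟨ top-returns x ⟩
          x                               ≡⟨ sym (lookup-orbit x zero) ⟩
          lookup (orbit x) zero           ≡⟨ cong (lookup (orbit x)) (sym (rotate-last t t≡top)) ⟩
          lookup (orbit x) (rotate t)     ∎
          where open ≡-Reasoning
      by-position (no t≢top) = begin
          s (lookup (orbit x) t)          ≡⟨ cong s (lookup-orbit x t) ⟩
          iter s (suc (toℕ t)) x          ≡⟨ cong (λ z → iter s z x) (sym (toℕ-rotate t t≢top)) ⟩
          iter s (toℕ (rotate t)) x       ≡⟨ sym (lookup-orbit x (rotate t)) ⟩
          lookup (orbit x) (rotate t)     ∎
          where open ≡-Reasoning
    moves : 1 ≤ top x → ∀ t → s (lookup (orbit x) t) ≢ lookup (orbit x) t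
    moves 1≤top t e = top-minimal x 1 ≤-refl 1≤top
      (subst (λ z → iter s z x ≡ x) (m+n∸n≡m 1 (toℕ t))
             (cancel x (n≤1+n (toℕ t)) (sym (trans (cong s (sym (lookup-orbit x t))) (trans e (lookup-orbit x t))))))

  leaders : List (Fin n)
  leaders = filter leader? (allFin n)

  cycles : List (Cycle n)
  cycles = L.map (λ x → top x , orbit x) leaders

  cycles-isCycle : All (IsCycle σ) cycles
  cycles-isCycle = All.map⁺ (All.tabulate (λ {x} _ → orbit-isCycle x))

  leastIndex : ∀ x → Fin (suc (top x))
  leastIndex x = proj₁ (argmin (λ t → toℕ (iter s (toℕ t) x)))

  leastIndex-least : ∀ x t → toℕ (iter s (toℕ (leastIndex x)) x) ≤ toℕ (iter s (toℕ t) x)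
  leastIndex-least x = proj₂ (argmin (λ t → toℕ (iter s (toℕ {suc (top x)} t) x)))

  leaderOf : Fin n → Fin n
  leaderOf x = iter s (toℕ (leastIndex x)) x

  leaderOf-leader : ∀ x → Leader (leaderOf x)
  leaderOf-leader x t with orbit-reduce x (toℕ t + toℕ (leastIndex x))
  ... | r , r≤top , e = subst (λ z → toℕ (leaderOf x) ≤ toℕ z) same (leastIndex-least x (F.fromℕ< (s≤s r≤top)))
    where
    same : iter s (toℕ (F.fromℕ< {r} {suc (top x)} (s≤s r≤top))) x ≡ iter s (toℕ t) (leaderOf x)
    same = trans (cong (λ z → iter s z x) (toℕ-fromℕ< (s≤s r≤top)))
                 (trans (sym e) (iter-+ s (toℕ t) (toℕ (leastIndex x)) x))

  ∈-orbit-leaderOf : ∀ x → x ∈ toList (orbit (leaderOf x))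
  ∈-orbit-leaderOf x with orbit-back x (toℕ (leastIndex x))
  ... | u , back with orbit-reduce (leaderOf x) u
  ...   | r , r≤top , e = subst (_∈ toList (orbit (leaderOf x))) (begin
      lookup (orbit (leaderOf x)) t       ≡⟨ lookup-orbit (leaderOf x) t ⟩
      iter s (toℕ t) (leaderOf x)         ≡⟨ cong (λ z → iter s z (leaderOf x)) (toℕ-fromℕ< (s≤s r≤top)) ⟩
      iter s r (leaderOf x)               ≡⟨ sym e ⟩
      iter s u (leaderOf x)               ≡⟨ back ⟩
      x                                   ∎) (lookup∈toList (orbit (leaderOf x)) t)
    where
    open ≡-Reasoning
    t : Fin (suc (top (leaderOf x)))
    t = F.fromℕ< {r} {suc (top (leaderOf x))} (s≤s r≤top)

  cycles-complete : ∀ x → x ∈ cyclePoints cycles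
  cycles-complete x =
    on-cycle leaders (∈-filter⁺ leader? {xs = allFin n} (∈-allFin (leaderOf x)) (leaderOf-leader x)) (∈-orbit-leaderOf x)
    where
    on-cycle : ∀ xs {x y} → x ∈ xs → y ∈ toList (orbit x) → y ∈ cyclePoints (L.map (λ x → top x , orbit x) xs)
    on-cycle (z ∷ xs) (here refl) y∈ = ∈-++⁺ˡ y∈
    on-cycle (z ∷ xs) (there x∈)  y∈ = ∈-++⁺ʳ (toList (orbit z)) (on-cycle xs x∈ y∈)

  cycles-unique : Unique (cyclePoints cycles)
  cycles-unique = disjoint-orbits leaders (Unique.filter⁺ leader? (Unique.allFin⁺ n))
                                          (All.tabulate (λ x∈ → proj₂ (∈-filter⁻ leader? {xs = allFin n} x∈)))
    where
    on-some-cycle : ∀ xs {y} → y ∈ cyclePoints (L.map (λ x → top x , orbit x) xs) →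
                    Σ (Fin n) λ x → x ∈ xs × y ∈ toList (orbit x)
    on-some-cycle (x ∷ xs) y∈ with ∈-++⁻ (toList (orbit x)) y∈
    ... | inj₁ y∈x  = x , here refl , y∈x
    ... | inj₂ y∈xs with on-some-cycle xs y∈xs
    ...   | x′ , x′∈ , y∈x′ = x′ , there x′∈ , y∈x′

    disjoint-orbits : ∀ xs → Unique xs → All Leader xs → Unique (cyclePoints (L.map (λ x → top x , orbit x) xs))
    disjoint-orbits []       _          _                 = []
    disjoint-orbits (x ∷ xs) (x∉ ∷ u)  (leader ∷ leaders′) =
      Unique.++⁺ (orbit-unique x) (disjoint-orbits xs u leaders′) disjoint
      where
      disjoint : ∀ {y} → ¬ (y ∈ toList (orbit x) × y ∈ cyclePoints (L.map (λ x → top x , orbit x) xs))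
      disjoint (y∈x , y∈xs) with on-some-cycle xs y∈xs | ∈toList⇒lookup (orbit x) y∈x
      ... | x′ , x′∈ , y∈x′ | t , lt with ∈toList⇒lookup (orbit x′) y∈x′
      ...   | t′ , lt′ = All.lookup x∉ x′∈ (leader-unique x x′ leader (All.lookup leaders′ x′∈) (toℕ t) (toℕ t′)
                           (trans (sym (lookup-orbit x t)) (trans lt (trans (sym lt′) (lookup-orbit x′ t′)))))

  cycles-length : length (cyclePoints cycles) ≡ n
  cycles-length = unique-complete⇒length (cyclePoints cycles) cycles-unique cycles-complete

module BundleLists {n : ℕ} (k : ℕ) (σ : Permutation′ n) where
  open Bundles k σ

  points-++ : ∀ G G′ → points (G ++ G′) ≡ points G ++ points G′
  points-++ []            G′ = refl
  points-++ ((l , W) ∷ G) G′ = trans (cong (bundlePoints W ++_) (points-++ G G′)) (sym (++-assoc (bundlePoints W) _ _))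

  cost-++ : ∀ G G′ → cost (G ++ G′) ≡ cost G + cost G′
  cost-++ []            G′ = refl
  cost-++ ((l , W) ∷ G) G′ = trans (cong (sum (λ j → seqCost (lookup W j)) +_) (cost-++ G G′))
                                   (sym (+-assoc (sum (λ j → seqCost (lookup W j))) (cost G) (cost G′)))

  length-points : ∀ G → length (points G) ≡ k * size G
  length-points []            = sym (*-zeroʳ k)
  length-points ((l , W) ∷ G) = begin
      length (bundlePoints W ++ points G)               ≡⟨ length-++ (bundlePoints W) ⟩
      length (bundlePoints W) + length (points G)       ≡⟨ cong₂ _+_ (length-bundlePoints W) (length-points G) ⟩
      k * suc l + k * size G                            ≡⟨ sym (*-distribˡ-+ k (suc l) (size G)) ⟩
      k * (suc l + size G)                              ∎
    where
    open ≡-Reasoning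
    length-bundlePoints : ∀ {L k′} (W : Vec (Vec (Fin n) L) k′) → length (bundlePoints W) ≡ k′ * L
    length-bundlePoints V.[]       = refl
    length-bundlePoints (w V.∷ W) = trans (length-++ (toList w)) (cong₂ _+_ (length-toList w) (length-bundlePoints W))

  tuples : ∀ l → List (Vec (Vec (Fin n) (suc l)) k) → List Bundle
  tuples l = L.map (l ,_)

  points-tuples : ∀ l ws → points (tuples l ws) ≡ flatten (flatten ws)
  points-tuples l []       = refl
  points-tuples l (W ∷ ws) =
    trans (cong₂ _++_ (bundlePoints≡flatten W) (points-tuples l ws)) (sym (flatten-++ (toList W) (flatten ws)))
    where
    bundlePoints≡flatten : ∀ {L k′} (W : Vec (Vec (Fin n) L) k′) → bundlePoints W ≡ flatten (toList W)
    bundlePoints≡flatten V.[]       = refl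
    bundlePoints≡flatten (w V.∷ W) = cong (toList w ++_) (bundlePoints≡flatten W)

  size-tuples : ∀ l ws → size (tuples l ws) ≡ length ws * suc l
  size-tuples l []       = refl
  size-tuples l (W ∷ ws) = cong (suc l +_) (size-tuples l ws)

  seqsCost : ∀ {l} → List (Vec (Fin n) (suc l)) → ℕ
  seqsCost []       = 0
  seqsCost (v ∷ vs) = seqCost v + seqsCost vs

  seqsCost-++ : ∀ {l} (vs ws : List (Vec (Fin n) (suc l))) → seqsCost (vs ++ ws) ≡ seqsCost vs + seqsCost ws
  seqsCost-++ []       ws = refl
  seqsCost-++ (v ∷ vs) ws = trans (cong (seqCost v +_) (seqsCost-++ vs ws)) (sym (+-assoc (seqCost v) _ _))

  cost-tuples : ∀ l ws → cost (tuples l ws) ≡ seqsCost (flatten ws)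
  cost-tuples l []       = refl
  cost-tuples l (W ∷ ws) = trans (cong₂ _+_ (sum-lookup W) (cost-tuples l ws)) (sym (seqsCost-++ (toList W) _))
    where
    sum-lookup : ∀ {k′} (W : Vec (Vec (Fin n) (suc l)) k′) → sum (λ j → seqCost (lookup W j)) ≡ seqsCost (toList W)
    sum-lookup V.[]       = refl
    sum-lookup (w V.∷ W) = cong (seqCost w +_) (sum-lookup W)

  seqCost-cycle : ∀ {l} (v : Vec (Fin n) (suc l)) → IsCycle σ (l , v) → seqCost v ≡ 0
  seqCost-cycle {l} v (steps , _) =
    trans (sum-cong-≗ (λ t → trans (cong (mismatch (lookup v (rotate t))) (steps t)) (mismatch-refl _)))
          (trans (sum-const (suc l) 0) (*-zeroʳ (suc l)))

  seqsCost-cycles : ∀ {l} (vs : List (Vec (Fin n) (suc l))) → All (λ v → IsCycle σ (l , v)) vs → seqsCost vs ≡ 0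
  seqsCost-cycles []       []               = refl
  seqsCost-cycles (v ∷ vs) (cyc ∷ cycles) = cong₂ _+_ (seqCost-cycle v cyc) (seqsCost-cycles vs cycles)

  seqCost≤length : ∀ {l} (v : Vec (Fin n) (suc l)) → seqCost v ≤ suc l
  seqCost≤length {l} v = ≤-trans (sum-mono (λ t → mismatch≤1 (lookup v (rotate t)) (σ ⟨$⟩ʳ lookup v t)))
                                 (≤-reflexive (trans (sum-const (suc l) 1) (*-identityʳ (suc l))))

  seqsCost≤length : ∀ (vs : List (Vec (Fin n) 1)) → seqsCost vs ≤ length vs
  seqsCost≤length []       = z≤n
  seqsCost≤length (v ∷ vs) = +-mono-≤ (seqCost≤length v) (seqsCost≤length vs)

  breaks : List (Fin n) → ℕ
  breaks []          = 0
  breaks (x ∷ [])    = 0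
  breaks (x ∷ y ∷ r) = mismatch y (σ ⟨$⟩ʳ x) + breaks (y ∷ r)

  breaks-++-≥ : ∀ xs ys → breaks xs + breaks ys ≤ breaks (xs ++ ys)
  breaks-++-≥ []          ys       = ≤-refl
  breaks-++-≥ (x ∷ [])    []       = z≤n
  breaks-++-≥ (x ∷ [])    (y ∷ ys) = m≤n+m _ _
  breaks-++-≥ (x ∷ y ∷ r) ys       =
    ≤-trans (≤-reflexive (+-assoc (mismatch y (σ ⟨$⟩ʳ x)) _ _))
            (+-monoʳ-≤ (mismatch y (σ ⟨$⟩ʳ x)) (breaks-++-≥ (y ∷ r) ys))

  breaks-++-≤ : ∀ xs ys → breaks (xs ++ ys) ≤ breaks xs + suc (breaks ys)
  breaks-++-≤ []          ys       = n≤1+n _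
  breaks-++-≤ (x ∷ [])    []       = z≤n
  breaks-++-≤ (x ∷ [])    (y ∷ ys) = +-monoˡ-≤ _ (mismatch≤1 y (σ ⟨$⟩ʳ x))
  breaks-++-≤ (x ∷ y ∷ r) ys       =
    ≤-trans (+-monoʳ-≤ (mismatch y (σ ⟨$⟩ʳ x)) (breaks-++-≤ (y ∷ r) ys))
            (≤-reflexive (sym (+-assoc (mismatch y (σ ⟨$⟩ʳ x)) _ _)))

  breaks≡sum : ∀ {l} (v : Vec (Fin n) (suc l)) →
               breaks (toList v) ≡ sum {l} (λ t → mismatch (lookup v (suc t)) (σ ⟨$⟩ʳ lookup v (F.inject₁ t)))
  breaks≡sum {zero}  (x V.∷ V.[])     = refl
  breaks≡sum {suc l} (x V.∷ y V.∷ w) = cong (mismatch y (σ ⟨$⟩ʳ x) +_) (breaks≡sum (y V.∷ w))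

  seqCost≤breaks : ∀ {l} (v : Vec (Fin n) (suc l)) → seqCost v ≤ suc (breaks (toList v))
  seqCost≤breaks {l} v = begin
      seqCost v
    ≡⟨ sum-init-last (λ t → mismatch (lookup v (rotate t)) (σ ⟨$⟩ʳ lookup v t)) ⟩
      sum {l} (λ t → mismatch (lookup v (rotate (F.inject₁ t))) (σ ⟨$⟩ʳ lookup v (F.inject₁ t)))
        + mismatch (lookup v (rotate (F.fromℕ l))) (σ ⟨$⟩ʳ lookup v (F.fromℕ l))
    ≤⟨ +-mono-≤ (≤-reflexive (sum-cong-≗ (λ t → cong (λ z → mismatch (lookup v z) (σ ⟨$⟩ʳ lookup v (F.inject₁ t)))
                                                      (rotate-inject₁ t))))
                (mismatch≤1 _ _) ⟩
      sum {l} (λ t → mismatch (lookup v (suc t)) (σ ⟨$⟩ʳ lookup v (F.inject₁ t))) + 1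
    ≡⟨ trans (+-comm _ 1) (cong suc (sym (breaks≡sum v))) ⟩
      suc (breaks (toList v)) ∎
    where open ≤-Reasoning

  breaks-cycle : ∀ {l} (v : Vec (Fin n) (suc l)) → IsCycle σ (l , v) → breaks (toList v) ≡ 0
  breaks-cycle {l} v (steps , _) =
    trans (breaks≡sum v) (trans (sum-cong-≗ λ t →
      trans (cong (mismatch (lookup v (suc t))) (trans (steps (F.inject₁ t)) (cong (lookup v) (rotate-inject₁ t))))
            (mismatch-refl _)) (trans (sum-const l 0) (*-zeroʳ l)))

  seqsCost-blocks : ∀ {l} (vs : List (Vec (Fin n) (suc l))) → seqsCost vs ≤ breaks (flatten vs) + length vs
  seqsCost-blocks []       = z≤n
  seqsCost-blocks (v ∷ vs) = begin
      seqCost v + seqsCost vs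
    ≤⟨ +-mono-≤ (seqCost≤breaks v) (seqsCost-blocks vs) ⟩
      suc (breaks (toList v)) + (breaks (flatten vs) + length vs)
    ≡⟨ cong suc (sym (+-assoc (breaks (toList v)) _ _)) ⟩
      suc (breaks (toList v) + breaks (flatten vs) + length vs)
    ≤⟨ s≤s (+-monoˡ-≤ (length vs) (breaks-++-≥ (toList v) _)) ⟩
      suc (breaks (toList v ++ flatten vs) + length vs)
    ≡⟨ sym (+-suc _ (length vs)) ⟩
      breaks (flatten (v ∷ vs)) + length (v ∷ vs) ∎
    where open ≤-Reasoning

  -- Concatenating cycles of σ breaks only at the junctions.
  breaks-cycles : ∀ (C : List (Cycle n)) → All (IsCycle σ) C → breaks (cyclePoints C) ≤ length C
  breaks-cycles []            []             = z≤n
  breaks-cycles ((l , v) ∷ C) (cyc ∷ cycles) = begin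
      breaks (toList v ++ cyclePoints C)           ≤⟨ breaks-++-≤ (toList v) (cyclePoints C) ⟩
      breaks (toList v) + suc (breaks (cyclePoints C)) ≡⟨ cong (_+ suc (breaks (cyclePoints C))) (breaks-cycle v cyc) ⟩
      suc (breaks (cyclePoints C))                 ≤⟨ s≤s (breaks-cycles C cycles) ⟩
      suc (length C)                               ∎
    where open ≤-Reasoning

  length-cyclePoints : ∀ c (C : List (Cycle n)) → All (λ cy → c ≤ proj₁ cy) C → length C * suc c ≤ length (cyclePoints C)
  length-cyclePoints c []            []          = z≤n
  length-cyclePoints c ((l , v) ∷ C) (c≤l ∷ c≤C) =
    ≤-trans (+-mono-≤ (s≤s c≤l) (length-cyclePoints c C c≤C))
            (≤-reflexive (sym (trans (length-++ (toList v)) (cong (_+ length (cyclePoints C)) (length-toList v)))))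

  cyclePoints-moved : ∀ (C : List (Cycle n)) → All (λ cy → 1 ≤ proj₁ cy) C → All (IsCycle σ) C →
                      All (λ x → σ ⟨$⟩ʳ x ≢ x) (cyclePoints C)
  cyclePoints-moved []            []          []                    = []
  cyclePoints-moved ((l , v) ∷ C) (1≤l ∷ 1≤C) ((_ , moves) ∷ cycles) =
    All.++⁺ (All.tabulate moved) (cyclePoints-moved C 1≤C cycles)
    where
    moved : ∀ {x} → x ∈ toList v → σ ⟨$⟩ʳ x ≢ x
    moved x∈v with ∈toList⇒lookup v x∈v
    ... | t , refl = moves 1≤l t

  keeps-singles : ∀ ws → All KeepsFixedPoints (tuples 0 ws)
  keeps-singles ws = All.map⁺ (All.tabulate (λ _ _ _ _ → refl))

  keeps-moved : ∀ l ws → All (λ x → σ ⟨$⟩ʳ x ≢ x) (flatten (flatten ws)) → All KeepsFixedPoints (tuples l ws)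
  keeps-moved l ws moved =
    All.map⁺ (All.map (λ moved-W j t fixed → ⊥-elim (moved-W j t fixed))
                      (All-flatten⁻ ws (All-flatten⁻ (flatten ws) moved)))

  keeps-cycles : ∀ l ws → All (λ v → IsCycle σ (l , v)) (flatten ws) → All KeepsFixedPoints (tuples l ws)
  keeps-cycles zero    ws _      = keeps-singles ws
  keeps-cycles (suc l) ws cycles =
    All.map⁺ (All.map (λ cycles-W j t fixed → ⊥-elim (proj₂ (cycles-W j) (s≤s z≤n) t fixed)) (All-flatten⁻ ws cycles))

module Construction {n : ℕ} (k : ℕ) (σ : Permutation′ n) (1≤k : 1 ≤ k) where
  open Bundles k σ
  open BundleLists k σ

  ofLength : ∀ ℓ → List (Cycle n) → List (Vec (Fin n) (suc ℓ)) × List (Cycle n)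
  ofLength ℓ []            = [] , []
  ofLength ℓ ((l , v) ∷ C) with l ≟ ℓ
  ... | yes refl = v ∷ proj₁ (ofLength ℓ C) , proj₂ (ofLength ℓ C)
  ... | no  _    = proj₁ (ofLength ℓ C) , (l , v) ∷ proj₂ (ofLength ℓ C)

  ofLength-↭ : ∀ ℓ C → cyclePoints C ↭ flatten (proj₁ (ofLength ℓ C)) ++ cyclePoints (proj₂ (ofLength ℓ C))
  ofLength-↭ ℓ []            = ↭-refl
  ofLength-↭ ℓ ((l , v) ∷ C) with l ≟ ℓ
  ... | yes refl = ↭-trans (↭.++⁺ˡ (toList v) (ofLength-↭ ℓ C)) (↭-reflexive (sym (++-assoc (toList v) _ _)))
  ... | no  _    = ↭-trans (↭.++⁺ˡ (toList v) (ofLength-↭ ℓ C)) (↭.shifts (toList v) (flatten (proj₁ (ofLength ℓ C))))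

  ofLength-cycles : ∀ ℓ C → All (IsCycle σ) C →
                    All (λ v → IsCycle σ (ℓ , v)) (proj₁ (ofLength ℓ C)) × All (IsCycle σ) (proj₂ (ofLength ℓ C))
  ofLength-cycles ℓ []            []               = [] , []
  ofLength-cycles ℓ ((l , v) ∷ C) (cyc ∷ cycles) with l ≟ ℓ
  ... | yes refl = cyc ∷ proj₁ (ofLength-cycles ℓ C cycles) , proj₂ (ofLength-cycles ℓ C cycles)
  ... | no  _    = proj₁ (ofLength-cycles ℓ C cycles) , cyc ∷ proj₂ (ofLength-cycles ℓ C cycles)

  ofLength-longer : ∀ ℓ C → All (λ cy → ℓ ≤ proj₁ cy) C → All (λ cy → suc ℓ ≤ proj₁ cy) (proj₂ (ofLength ℓ C))
  ofLength-longer ℓ []            []          = []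
  ofLength-longer ℓ ((l , v) ∷ C) (ℓ≤l ∷ ℓ≤C) with l ≟ ℓ
  ... | yes refl = ofLength-longer ℓ C ℓ≤C
  ... | no  l≢ℓ  = ≤∧≢⇒< ℓ≤l (λ ℓ≡l → l≢ℓ (sym ℓ≡l)) ∷ ofLength-longer ℓ C ℓ≤C

  -- Short cycles: for each length ℓ + 1, …, ℓ + r the cycles are bundled k at a time at
  -- no cost; fewer than k cycles of each length are left over as loose points.
  record ShortBundling (ℓ r : ℕ) (C : List (Cycle n)) : Set where
    field
      bundles        : List Bundle
      loose          : List (Fin n)
      longer         : List (Cycle n)
      points-↭       : cyclePoints C ↭ points bundles ++ (loose ++ cyclePoints longer)
      keeps          : All KeepsFixedPoints bundles
      free           : cost bundles ≡ 0
      short          : All (λ g → suc (proj₁ g) ≤ ℓ + r) bundles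
      few            : length loose ≤ r * (k * (ℓ + r))
      longer-cycles  : All (IsCycle σ) longer
      longer-long    : All (λ cy → ℓ + r ≤ proj₁ cy) longer

  bundleShort : ∀ ℓ r C → All (IsCycle σ) C → All (λ cy → ℓ ≤ proj₁ cy) C → ShortBundling ℓ r C
  bundleShort ℓ zero C cycles long = record
    { bundles = [] ; loose = [] ; longer = C ; points-↭ = ↭-refl ; keeps = [] ; free = refl
    ; short = [] ; few = z≤n ; longer-cycles = cycles
    ; longer-long = All.map (≤-trans (≤-reflexive (+-identityʳ ℓ))) long }
  bundleShort ℓ (suc r) C cycles long = record
    { bundles = tuples ℓ ws ++ S.bundles
    ; loose = flatten lo ++ S.loose
    ; longer = S.longer
    ; points-↭ = points-↭
    ; keeps = All.++⁺ (keeps-cycles ℓ ws ws-cycles) S.keeps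
    ; free = trans (cost-++ (tuples ℓ ws) S.bundles)
                   (cong₂ _+_ (trans (cost-tuples ℓ ws) (seqsCost-cycles (flatten ws) ws-cycles)) S.free)
    ; short = All.++⁺ (All.map⁺ (All.tabulate (λ _ → ≤-trans (s≤s (m≤m+n ℓ r)) (≤-reflexive (sym (+-suc ℓ r))))))
                      (All.map (λ l< → ≤-trans l< (≤-reflexive (sym (+-suc ℓ r)))) S.short)
    ; few = few
    ; longer-cycles = S.longer-cycles
    ; longer-long = All.map (≤-trans (≤-reflexive (+-suc ℓ r))) S.longer-long }
    where
    vs : List (Vec (Fin n) (suc ℓ))
    vs = proj₁ (ofLength ℓ C)
    C′ : List (Cycle n)
    C′ = proj₂ (ofLength ℓ C)
    B : Blocks k vs
    B = cut k 1≤k vs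
    open Blocks B using (split) renaming (leftover to lo; blocks to ws)
    module S = ShortBundling (bundleShort (suc ℓ) r C′ (proj₂ (ofLength-cycles ℓ C cycles)) (ofLength-longer ℓ C long))

    ws-cycles : All (λ v → IsCycle σ (ℓ , v)) (flatten ws)
    ws-cycles = All.++⁻ʳ lo (subst (All (λ v → IsCycle σ (ℓ , v))) split (proj₁ (ofLength-cycles ℓ C cycles)))

    points-↭ : cyclePoints C ↭ points (tuples ℓ ws ++ S.bundles) ++ ((flatten lo ++ S.loose) ++ cyclePoints S.longer)
    points-↭ = begin
        cyclePoints C
      ↭⟨ ofLength-↭ ℓ C ⟩
        flatten vs ++ cyclePoints C′
      ≡⟨ cong (_++ cyclePoints C′) (trans (cong flatten split) (flatten-++ lo (flatten ws))) ⟩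
        (flatten lo ++ flatten (flatten ws)) ++ cyclePoints C′
      ≡⟨ trans (++-assoc (flatten lo) _ _) (cong (λ z → flatten lo ++ (z ++ cyclePoints C′)) (sym (points-tuples ℓ ws))) ⟩
        flatten lo ++ (points (tuples ℓ ws) ++ cyclePoints C′)
      ↭⟨ ↭.shifts (flatten lo) (points (tuples ℓ ws)) ⟩
        points (tuples ℓ ws) ++ (flatten lo ++ cyclePoints C′)
      ↭⟨ ↭.++⁺ˡ (points (tuples ℓ ws)) (↭.++⁺ˡ (flatten lo) S.points-↭) ⟩
        points (tuples ℓ ws) ++ (flatten lo ++ (points S.bundles ++ (S.loose ++ cyclePoints S.longer)))
      ↭⟨ ↭.++⁺ˡ (points (tuples ℓ ws)) (↭.shifts (flatten lo) (points S.bundles)) ⟩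
        points (tuples ℓ ws) ++ (points S.bundles ++ (flatten lo ++ (S.loose ++ cyclePoints S.longer)))
      ≡⟨ sym (trans (cong₂ _++_ (points-++ (tuples ℓ ws) S.bundles) (++-assoc (flatten lo) S.loose _))
                    (++-assoc (points (tuples ℓ ws)) (points S.bundles) _)) ⟩
        points (tuples ℓ ws ++ S.bundles) ++ ((flatten lo ++ S.loose) ++ cyclePoints S.longer) ∎
      where open PermutationReasoning

    few : length (flatten lo ++ S.loose) ≤ suc r * (k * (ℓ + suc r))
    few = begin
        length (flatten lo ++ S.loose)
      ≡⟨ trans (length-++ (flatten lo)) (cong (_+ length S.loose) (length-flatten lo)) ⟩
        length lo * suc ℓ + length S.loose
      ≤⟨ +-mono-≤ (*-mono-≤ (<⇒≤ (Blocks.few B)) (s≤s (m≤m+n ℓ r))) S.few ⟩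
        k * suc (ℓ + r) + r * (k * (suc ℓ + r))
      ≡⟨ cong₂ (λ a b → k * a + r * (k * b)) (sym (+-suc ℓ r)) (sym (+-suc ℓ r)) ⟩
        k * (ℓ + suc r) + r * (k * (ℓ + suc r)) ∎
      where open ≤-Reasoning

  -- Long cycles: the cycles of length > c are concatenated and cut into blocks of c
  -- consecutive points; the blocks, closed into c-cycles, are bundled k at a time.
  -- Fewer than c points and fewer than k blocks are left over.
  record LongBundling (c : ℕ) (C : List (Cycle n)) : Set where
    field
      bundles  : List Bundle
      loose    : List (Fin n)
      points-↭ : cyclePoints C ↭ points bundles ++ loose
      keeps    : All KeepsFixedPoints bundles
      short    : All (λ g → suc (proj₁ g) ≤ c) bundles
      cheap    : cost bundles * c ≤ 2 * length (cyclePoints C)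
      few      : length loose ≤ c + k * c

  bundleLong : ∀ c′ C → All (IsCycle σ) C → All (λ cy → suc c′ ≤ proj₁ cy) C → LongBundling (suc c′) C
  bundleLong c′ C cycles long = record
    { bundles = tuples c′ ws
    ; loose = P′ ++ flatten lc
    ; points-↭ = ↭-trans (↭-reflexive (trans P-split (sym (++-assoc P′ (flatten lc) _))))
                         (↭.++-comm (P′ ++ flatten lc) (points (tuples c′ ws)))
    ; keeps = keeps-moved c′ ws (subst (All (λ x → σ ⟨$⟩ʳ x ≢ x)) (points-tuples c′ ws)
                (All.++⁻ʳ (flatten lc) (All.++⁻ʳ P′ (subst (All (λ x → σ ⟨$⟩ʳ x ≢ x)) P-split
                  (cyclePoints-moved C (All.map (≤-trans (s≤s z≤n)) long) cycles)))))
    ; short = All.map⁺ (All.tabulate (λ _ → ≤-refl))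
    ; cheap = cheap
    ; few = few
    }
    where
    c : ℕ
    c = suc c′
    P : List (Fin n)
    P = cyclePoints C
    B₁ : Blocks c P
    B₁ = cut c (s≤s z≤n) P
    B₂ : Blocks k (Blocks.blocks B₁)
    B₂ = cut k 1≤k (Blocks.blocks B₁)
    open Blocks B₁ using () renaming (leftover to P′; blocks to bs; split to P≡)
    open Blocks B₂ using () renaming (leftover to lc; blocks to ws; split to bs≡)

    P-split : P ≡ P′ ++ (flatten lc ++ points (tuples c′ ws))
    P-split = trans P≡ (cong (P′ ++_) (trans (cong flatten bs≡)
                (trans (flatten-++ lc (flatten ws)) (cong (flatten lc ++_) (sym (points-tuples c′ ws))))))

    -- Closed blocks cost at most one per block besides the junctions of the cycles.
    cost≤ : cost (tuples c′ ws) ≤ length C + length bs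
    cost≤ = begin
        cost (tuples c′ ws)                     ≡⟨ cost-tuples c′ ws ⟩
        seqsCost (flatten ws)                   ≤⟨ m≤n+m _ _ ⟩
        seqsCost lc + seqsCost (flatten ws)     ≡⟨ sym (trans (cong seqsCost bs≡) (seqsCost-++ lc (flatten ws))) ⟩
        seqsCost bs                             ≤⟨ seqsCost-blocks bs ⟩
        breaks (flatten bs) + length bs         ≤⟨ +-monoˡ-≤ (length bs) breaks-bs≤ ⟩
        length C + length bs                    ∎
      where
      open ≤-Reasoning
      breaks-bs≤ : breaks (flatten bs) ≤ length C
      breaks-bs≤ = ≤-trans (m≤n+m _ _) (≤-trans (breaks-++-≥ P′ (flatten bs))
                     (≤-trans (≤-reflexive (cong breaks (sym P≡))) (breaks-cycles C cycles)))

    cheap : cost (tuples c′ ws) * c ≤ 2 * length P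
    cheap = begin
        cost (tuples c′ ws) * c              ≤⟨ *-monoˡ-≤ c cost≤ ⟩
        (length C + length bs) * c           ≡⟨ *-distribʳ-+ c (length C) (length bs) ⟩
        length C * c + length bs * c         ≤⟨ +-mono-≤ (≤-trans (*-monoʳ-≤ (length C) (n≤1+n c)) (length-cyclePoints c C long))
                                                          (≤-trans (m≤n+m _ _) (≤-reflexive (sym (Blocks.length-split B₁)))) ⟩
        length P + length P                  ≡⟨ cong (length P +_) (sym (+-identityʳ (length P))) ⟩
        2 * length P                         ∎
      where open ≤-Reasoning

    few : length (P′ ++ flatten lc) ≤ c + k * c
    few = begin
        length (P′ ++ flatten lc)           ≡⟨ trans (length-++ P′) (cong (length P′ +_) (length-flatten lc)) ⟩
        length P′ + length lc * c           ≤⟨ +-mono-≤ (<⇒≤ (Blocks.few B₁)) (*-monoˡ-≤ c (<⇒≤ (Blocks.few B₂))) ⟩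
        c + k * c                           ∎
      where open ≤-Reasoning

  -- Loose points become fixed points of ρ, bundled k at a time at a cost of at most
  -- one each; fewer than k points remain spare.
  record SingleBundling (R : List (Fin n)) : Set where
    field
      bundles  : List Bundle
      spare    : List (Fin n)
      points-↭ : R ↭ points bundles ++ spare
      keeps    : All KeepsFixedPoints bundles
      short    : All (λ g → suc (proj₁ g) ≤ 1) bundles
      cheap    : cost bundles ≤ length R
      few      : length spare < k

  bundleSingles : ∀ R → SingleBundling R
  bundleSingles R = record
    { bundles = tuples 0 ws
    ; spare = flatten lo
    ; points-↭ = ↭-trans (↭-reflexive R-split) (↭.++-comm (flatten lo) (points (tuples 0 ws)))
    ; keeps = keeps-singles ws
    ; short = All.map⁺ (All.tabulate (λ _ → ≤-refl))
    ; cheap = cheap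
    ; few = subst (_< k) (sym (trans (length-flatten lo) (*-identityʳ (length lo)))) (Blocks.few B)
    }
    where
    B : Blocks k (singletons R)
    B = cut k 1≤k (singletons R)
    open Blocks B using (split) renaming (leftover to lo; blocks to ws)

    R-split : R ≡ flatten lo ++ points (tuples 0 ws)
    R-split = trans (sym (flatten-singletons R))
                (trans (cong flatten split) (trans (flatten-++ lo (flatten ws)) (cong (flatten lo ++_) (sym (points-tuples 0 ws)))))

    cheap : cost (tuples 0 ws) ≤ length R
    cheap = begin
        cost (tuples 0 ws)                       ≡⟨ cost-tuples 0 ws ⟩
        seqsCost (flatten ws)                    ≤⟨ m≤n+m _ _ ⟩
        seqsCost lo + seqsCost (flatten ws)      ≡⟨ sym (trans (cong seqsCost split) (seqsCost-++ lo (flatten ws))) ⟩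
        seqsCost (singletons R)                  ≤⟨ seqsCost≤length (singletons R) ⟩
        length (singletons R)                    ≡⟨ length-map _ R ⟩
        length R                                 ∎
      where open ≤-Reasoning

-- The loose points of the construction number O(k c²).
loose-bound : ∀ k c → 1 ≤ k → 1 ≤ c → (c * (k * c) + (c + k * c)) * c ≤ 3 * (k * c ^ 3)
loose-bound k c 1≤k 1≤c = begin
    (c * (k * c) + (c + k * c)) * c              ≡⟨ expand k c ⟩
    k * c ^ 3 + (1 * (c * c) * 1 + k * (c * c) * 1)  ≤⟨ +-monoʳ-≤ (k * c ^ 3) (+-mono-≤ (*-mono-≤ (*-monoˡ-≤ (c * c) 1≤k) 1≤c)
                                                                                     (*-monoʳ-≤ (k * (c * c)) 1≤c)) ⟩
    k * c ^ 3 + (k * (c * c) * c + k * (c * c) * c)  ≡⟨ collect k c ⟩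
    3 * (k * c ^ 3)                                  ∎
  where
  open ≤-Reasoning
  expand : ∀ k c → (c * (k * c) + (c + k * c)) * c ≡ k * (c * (c * (c * 1))) + (1 * (c * c) * 1 + k * (c * c) * 1)
  expand = solve-∀
  collect : ∀ k c → k * (c * (c * (c * 1))) + (k * (c * c) * c + k * (c * c) * c) ≡ 3 * (k * (c * (c * (c * 1))))
  collect = solve-∀

record Bundling {n : ℕ} (k : ℕ) (σ : Permutation′ n) (c : ℕ) : Set where
  field
    bundles  : List (Bundles.Bundle k σ)
    spare    : ℕ
    spare<k  : spare < k
    count    : k * Bundles.size k σ bundles + spare ≡ n
    distinct : Unique (Bundles.points k σ bundles)
    keeps    : All (Bundles.KeepsFixedPoints k σ) bundles
    short    : All (λ g → suc (proj₁ g) ≤ c) bundles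
    cheap    : Bundles.cost k σ bundles * c ≤ 2 * n + 3 * (k * c ^ 3)

bundling : ∀ {n} (σ : Permutation′ n) k c → 1 ≤ k → 1 ≤ c → Bundling k σ c
bundling {n} σ k (suc c′) 1≤k 1≤c = record
  { bundles  = G
  ; spare    = length S₃.spare
  ; spare<k  = S₃.few
  ; count    = count
  ; distinct = proj₁ (unique-++⁻ (points G) (unique-resp-↭ all-↭ cycles-unique))
  ; keeps    = All.++⁺ S₁.keeps (All.++⁺ S₂.keeps S₃.keeps)
  ; short    = All.++⁺ S₁.short (All.++⁺ S₂.short (All.map (λ l<1 → ≤-trans l<1 1≤c) S₃.short))
  ; cheap    = cheap
  }
  where
  open Bundles k σ
  open BundleLists k σ
  open Orbits σ
  open Construction k σ 1≤k
  c : ℕ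
  c = suc c′
  module S₁ = ShortBundling (bundleShort 0 c cycles cycles-isCycle (All.tabulate (λ _ → z≤n)))
  module S₂ = LongBundling (bundleLong c′ S₁.longer S₁.longer-cycles S₁.longer-long)
  module S₃ = SingleBundling (bundleSingles (S₁.loose ++ S₂.loose))
  G : List Bundle
  G = S₁.bundles ++ (S₂.bundles ++ S₃.bundles)

  all-↭ : cyclePoints cycles ↭ points G ++ S₃.spare
  all-↭ = begin
      cyclePoints cycles
    ↭⟨ S₁.points-↭ ⟩
      points S₁.bundles ++ (S₁.loose ++ cyclePoints S₁.longer)
    ↭⟨ ↭.++⁺ˡ (points S₁.bundles) (↭.++⁺ˡ S₁.loose S₂.points-↭) ⟩
      points S₁.bundles ++ (S₁.loose ++ (points S₂.bundles ++ S₂.loose))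
    ↭⟨ ↭.++⁺ˡ (points S₁.bundles) (↭.shifts S₁.loose (points S₂.bundles)) ⟩
      points S₁.bundles ++ (points S₂.bundles ++ (S₁.loose ++ S₂.loose))
    ↭⟨ ↭.++⁺ˡ (points S₁.bundles) (↭.++⁺ˡ (points S₂.bundles) S₃.points-↭) ⟩
      points S₁.bundles ++ (points S₂.bundles ++ (points S₃.bundles ++ S₃.spare))
    ≡⟨ sym (trans (cong (_++ S₃.spare) (trans (points-++ S₁.bundles _) (cong (points S₁.bundles ++_) (points-++ S₂.bundles _))))
                  (trans (++-assoc (points S₁.bundles) _ _) (cong (points S₁.bundles ++_) (++-assoc (points S₂.bundles) _ _)))) ⟩
      points G ++ S₃.spare ∎
    where open PermutationReasoning

  count : k * size G + length S₃.spare ≡ n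
  count = begin
      k * size G + length S₃.spare                ≡⟨ cong (_+ length S₃.spare) (sym (length-points G)) ⟩
      length (points G) + length S₃.spare         ≡⟨ sym (length-++ (points G)) ⟩
      length (points G ++ S₃.spare)               ≡⟨ sym (↭.↭-length all-↭) ⟩
      length (cyclePoints cycles)                 ≡⟨ cycles-length ⟩
      n                                           ∎
    where open ≡-Reasoning

  long≤n : length (cyclePoints S₁.longer) ≤ n
  long≤n = ≤-trans (m≤n+m _ _) (≤-trans (m≤n+m _ (length (points S₁.bundles)))
             (≤-reflexive (trans (cong (length (points S₁.bundles) +_) (sym (length-++ S₁.loose)))
               (trans (sym (length-++ (points S₁.bundles))) (trans (sym (↭.↭-length S₁.points-↭)) cycles-length)))))

  cheap : cost G * c ≤ 2 * n + 3 * (k * c ^ 3)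
  cheap = begin
      cost G * c
    ≡⟨ cong (_* c) (trans (cost-++ S₁.bundles _) (trans (cong (_+ cost (S₂.bundles ++ S₃.bundles)) S₁.free)
                                                        (cost-++ S₂.bundles S₃.bundles))) ⟩
      (cost S₂.bundles + cost S₃.bundles) * c
    ≡⟨ *-distribʳ-+ c (cost S₂.bundles) (cost S₃.bundles) ⟩
      cost S₂.bundles * c + cost S₃.bundles * c
    ≤⟨ +-mono-≤ (≤-trans S₂.cheap (*-monoʳ-≤ 2 long≤n)) (*-monoˡ-≤ c S₃.cheap) ⟩
      2 * n + length (S₁.loose ++ S₂.loose) * c
    ≤⟨ +-monoʳ-≤ (2 * n) (*-monoˡ-≤ c (≤-trans (≤-reflexive (length-++ S₁.loose)) (+-mono-≤ S₁.few S₂.few))) ⟩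
      2 * n + (c * (k * c) + (c + k * c)) * c
    ≤⟨ +-monoʳ-≤ (2 * n) (loose-bound k c 1≤k 1≤c) ⟩
      2 * n + 3 * (k * c ^ 3) ∎
    where open ≤-Reasoning

*-+-cancel : ∀ k a b r → k * a + r ≡ k * b → r < k → a ≡ b
*-+-cancel (suc k′) a b r ka+r≡kb r<k = ≤-antisym a≤b (≤-pred b<1+a)
  where
  a≤b : a ≤ b
  a≤b = *-cancelˡ-≤ (suc k′) (≤-trans (m≤m+n _ r) (≤-reflexive ka+r≡kb))
  b<1+a : b < suc a
  b<1+a = *-cancelˡ-< (suc k′) b (suc a) (begin-strict
    suc k′ * b          ≡⟨ sym ka+r≡kb ⟩
    suc k′ * a + r      <⟨ +-monoʳ-< (suc k′ * a) r<k ⟩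
    suc k′ * a + suc k′ ≡⟨ +-comm (suc k′ * a) (suc k′) ⟩
    suc k′ + suc k′ * a ≡⟨ sym (*-suc (suc k′) a) ⟩
    suc k′ * suc a      ∎)
    where open ≤-Reasoning

ceilCbrt-spec : ∀ m → m ≤ ceilCbrt m ^ 3 × (∀ d → d < ceilCbrt m → d ^ 3 < m)
ceilCbrt-spec m = search (suc m) 0 (λ d ()) (≤-trans (n≤1+n m) (m≤m*n (suc m) (suc m * (suc m * 1))))
  where
  -- Searching upwards from c₀, every d < c₀ has d³ < m.
  search : ∀ fuel c₀ → (∀ d → d < c₀ → d ^ 3 < m) → m ≤ (c₀ + fuel) ^ 3 →
           m ≤ ceilCbrt-go m fuel c₀ ^ 3 × (∀ d → d < ceilCbrt-go m fuel c₀ → d ^ 3 < m)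
  search zero c₀ below enough = subst (λ z → m ≤ z ^ 3) (+-identityʳ c₀) enough , below
  search (suc fuel) c₀ below enough with m ≤? c₀ ^ 3
  ... | yes m≤c₀³ = m≤c₀³ , below
  ... | no  m≰c₀³ = search fuel (suc c₀) below′ (subst (λ z → m ≤ z ^ 3) (+-suc c₀ fuel) enough)
    where
    below′ : ∀ d → d < suc c₀ → d ^ 3 < m
    below′ d d<1+c₀ with m≤n⇒m<n∨m≡n (≤-pred d<1+c₀)
    ... | inj₁ d<c₀ = below d d<c₀
    ... | inj₂ refl = ≰⇒> m≰c₀³

suc-cube≤ : ∀ d → 4 ≤ d → suc d ^ 3 ≤ 2 * d ^ 3
suc-cube≤ d 4≤d = subst (λ z → suc z ^ 3 ≤ 2 * z ^ 3) (m∸n+n≡m 4≤d) (step (d ∸ 4))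
  where
  expand : ∀ e → 2 * ((e + 4) * ((e + 4) * ((e + 4) * 1)))
                 ≡ (e + 5) * ((e + 5) * ((e + 5) * 1)) + (e * e * e + 9 * (e * e) + 21 * e + 3)
  expand = solve-∀
  step : ∀ e → suc (e + 4) ^ 3 ≤ 2 * (e + 4) ^ 3
  step e = subst (λ z → z ^ 3 ≤ 2 * (e + 4) ^ 3) (+-suc e 4) (≤-trans (m≤m+n _ _) (≤-reflexive (sym (expand e))))

-- For m ≥ 65, c = ⌈∛m⌉ is at least 5, whence m ≤ c³ ≤ 2 m.
ceilCbrt-bounds : ∀ m → 65 ≤ m → 1 ≤ ceilCbrt m × m ≤ ceilCbrt m ^ 3 × ceilCbrt m ^ 3 ≤ 2 * m
ceilCbrt-bounds m 65≤m with ceilCbrt m | ceilCbrt-spec m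
... | c | m≤c³ , below with 5 ≤? c
...   | no  c≱5 = ⊥-elim (<-irrefl refl (≤-trans 65≤m (≤-trans m≤c³ (^-monoˡ-≤ 3 (≤-pred (≰⇒> c≱5))))))
...   | yes 5≤c with c
...     | suc c′ = s≤s z≤n , m≤c³ , ≤-trans (suc-cube≤ c′ (≤-pred 5≤c)) (*-monoʳ-≤ 2 (<⇒≤ (below c′ (n<1+n c′))))

-- With m ≤ c³ ≤ 2m, the cost bound H c ≤ 2km + 3kc³ gives H c ≤ 9km, i.e.
-- H / km ≤ 9 / ∛m, which cubed reads H³ m ≤ 729 (km)³.
distance-bound : ∀ k m c H → m ≤ c ^ 3 → c ^ 3 ≤ 2 * m →
                 H * c ≤ 2 * (k * m) + 3 * (k * c ^ 3) → H ^ 3 * m ≤ 729 * (k * m) ^ 3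
distance-bound k m c H m≤c³ c³≤2m Hc≤ = begin
    H ^ 3 * m           ≤⟨ *-monoʳ-≤ (H ^ 3) m≤c³ ⟩
    H ^ 3 * c ^ 3       ≡⟨ cube-* H c ⟩
    (H * c) ^ 3         ≤⟨ ^-monoˡ-≤ 3 Hc≤9km ⟩
    (9 * (k * m)) ^ 3   ≡⟨ sym (cube-9 (k * m)) ⟩
    729 * (k * m) ^ 3   ∎
  where
  open ≤-Reasoning
  cube-* : ∀ x y → (x * (x * (x * 1))) * (y * (y * (y * 1))) ≡ (x * y) * ((x * y) * ((x * y) * 1))
  cube-* = solve-∀
  cube-9 : ∀ x → 729 * (x * (x * (x * 1))) ≡ (9 * x) * ((9 * x) * ((9 * x) * 1))
  cube-9 = solve-∀
  eight : ∀ k m → 2 * (k * m) + 3 * (k * (2 * m)) ≡ 8 * (k * m)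
  eight = solve-∀
  Hc≤9km : H * c ≤ 9 * (k * m)
  Hc≤9km = begin
    H * c                                  ≤⟨ Hc≤ ⟩
    2 * (k * m) + 3 * (k * c ^ 3)          ≤⟨ +-monoʳ-≤ (2 * (k * m)) (*-monoʳ-≤ 3 (*-monoʳ-≤ k c³≤2m)) ⟩
    2 * (k * m) + 3 * (k * (2 * m))        ≡⟨ eight k m ⟩
    8 * (k * m)                            ≤⟨ *-monoˡ-≤ (k * m) (n≤1+n 8) ⟩
    9 * (k * m)                            ∎

proposition5p5 : Σ ℕ λ m₀ → ∀ m → m₀ ≤ m → ∀ k → 1 ≤ k → (σ : Permutation′ (k * m)) →
    Σ (Permutation′ (k * m)) λ ρ →
      FixedPointsSup ρ σ ×
      MaxCycleLen≤ ρ (ceilCbrt m) ×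
      (hamming ρ σ ^ 3 * m ≤ 729 * (k * m) ^ 3) ×
      (Σ (Permutation′ m) λ ρ̃ → Σ (Permutation′ m → Permutation′ (k * m)) λ Φ →
        IsIsometricEmbedding Φ × (ρ ≈ Φ ρ̃))
proposition5p5 = 65 , approximate
  where
  approximate : ∀ m → 65 ≤ m → ∀ k → 1 ≤ k → (σ : Permutation′ (k * m)) →
                Approximation k m σ (ceilCbrt m) (λ h → h ^ 3 * m ≤ 729 * (k * m) ^ 3)
  approximate m 65≤m k 1≤k σ =
    approximation-weaken {k} {m} {σ} {c}
      (λ h h≤cost → distance-bound k m c h m≤c³ c³≤2m (≤-trans (*-monoˡ-≤ c {h} h≤cost) cheap))
      (realise k (F.fromℕ< 1≤k) σ c bundles size≡m distinct keeps short)
    where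
    c : ℕ
    c = ceilCbrt m
    1≤c : 1 ≤ c
    1≤c = proj₁ (ceilCbrt-bounds m 65≤m)
    m≤c³ : m ≤ c ^ 3
    m≤c³ = proj₁ (proj₂ (ceilCbrt-bounds m 65≤m))
    c³≤2m : c ^ 3 ≤ 2 * m
    c³≤2m = proj₂ (proj₂ (ceilCbrt-bounds m 65≤m))
    open Bundling (bundling σ k c 1≤k 1≤c)
    size≡m : Bundles.size k σ bundles ≡ m
    size≡m = *-+-cancel k _ m spare count spare<k
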